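{- Let $n\ge1$. The relation $\mathbf{X}=\mathbf{I}/\mathbf{Y}$, i.e. the specification $\varphi(\mathbf{X},\mathbf{I},\mathbf{Y})$ that is true iff $\mathbf{X}\times\mathbf{Y}=\mathbf{I}$, with system inputs $(\mathbf{I},\mathbf{Y})$ and system outputs $\mathbf{X}$, and with the inputs restricted to odd numbers (i.e. $\varphi$ evaluates to $\bot$ whenever $\mathbf{I}$ or $\mathbf{Y}$ is even), is representable by a circuit of size polynomial in $n$ that is in SAUNF with respect to $\mathrm{set}(\mathbf{X})$ and some sequence of sets of leaves.
   Context: $\mathbf{X},\mathbf{Y}$ are sequences of $n$ Boolean variables and $\mathbf{I}$ a sequence of $2n$ Boolean variables, each read as an unsigned integer in binary; $\times$ denotes unsigned multiplication of $n$-bit integers (giving a $2n$-bit product). A circuit is an NNF circuit: a rooted DAG whose nodes are all descendants of the root, internal nodes labeled $\wedge$ or $\vee$ with two children, leaves labeled by literals or constants $\top,\bot$ (labels may repeat); size is the number of nodes, $\varphi_G$ the represented formula, $[\![\varphi_G]\!]$ its function. An $\ell$-leaf is a leaf labeled $\ell$; a set of leaves is literal-consistent if all carry the same literal. $G|_{L:b}$ relabels each leaf in $L$ by $b$; $G|_{\ell_1=b_1,\dots}$ relabels all $\ell_j$-leaves by $b_j$ ($\ell$, $\neg\ell$ distinct). $[\![\varphi]\!]_\sigma$ denotes substitution of an assignment $\sigma$. For a literal $\ell$ labeling a leaf of $G$ with variable $v_\ell$ and fresh $w,w'$: $\ell$ is $\wedge$-realizable in $G$ iff some assignment $\sigma$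 of all variables other than $v_\ell$ gives $[\![G|_{\ell=w,\neg\ell=w'}]\!]_\sigma=[\![w\wedge w']\!]$, else $\wedge$-unrealizable. A literal-consistent set $S$ of $\ell$-leaves, with $S'$ all $\ell$-leaves, is $\wedge$-(un)realizable in $G$ iff $\ell$ is $\wedge$-(un)realizable in $G|_{S'\setminus S:\bot}$. $G$ is in SAUNF w.r.t. $\mathrm{set}(\mathbf{X})$ and a non-empty sequence $S=(S_1,\dots,S_k)$ of leaf sets iff: the $S_j$ are pairwise disjoint; each $S_j$ is literal-consistent with a literal over $\mathbf{X}$; $S_1$ is $\wedge$-unrealizable in $G$; for $2\le j\le k$, $S_j$ is $\wedge$-unrealizable in $G|_{S_1:\top,\dots,S_{j-1}:\top}$; and $[\![\varphi_{G|_{S_1:\top,\dots,S_k:\top}}]\!]$ does not depend on $\mathbf{X}$. -}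

module Defs where

open import Data.Nat using (ℕ; zero; suc; _+_; _*_; _%_; _≡ᵇ_)
open import Data.Fin using (Fin; zero; suc)
import Data.Fin.Properties as FinP
open import Data.Bool using (Bool; true; false; _∧_; _∨_; not; if_then_else_)
open import Data.Maybe using (Maybe; just; nothing)
open import Data.Vec using (Vec; _∷_; []; head; lookup)
open import Data.List using (List; []; _∷_)
open import Data.List.Relation.Unary.All using (All)
open import Data.List.Relation.Unary.AllPairs using (AllPairs)
open import Data.Product using (Σ; _×_; _,_; proj₁; proj₂)
open import Data.Sum using (_⊎_)
open import Data.Empty using (⊥)
open import Data.Unit using (⊤)
open import Relation.Nullary using (¬_; yes; no)
open import Relation.Binary.PropositionalEquality using (_≡_; _≢_; refl)
open import Relation.Binary.Construct.Closure.ReflexiveTransitive using (Star)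
open import Data.Fin.Subset using (Subset)
open import Relation.Binary.Definitions using (DecidableEquality)
open import Relation.Nullary.Decidable using (⌊_⌋)

data Lit (V : Set) : Set where
  pos : V → Lit V
  neg : V → Lit V

litVar : {V : Set} → Lit V → V
litVar (pos v) = v
litVar (neg v) = v

negLit : {V : Set} → Lit V → Lit V
negLit (pos v) = neg v
negLit (neg v) = pos v

litVal : {V : Set} → (V → Bool) → Lit V → Bool
litVal σ (pos v) = σ v
litVal σ (neg v) = not (σ v)

data Label (V : Set) : Set where
  lit   : Lit V → Label V
  const : Bool → Label V

data Gate (V : Set) (k : ℕ) : Set where
  leaf : Label V → Gate V k
  and  : Fin k → Fin k → Gate V k
  or   : Fin k → Fin k → Gate V k

-- A DAG with k nodes, listed from the top: node `zero` is the most recently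
-- added node, and its children are among the remaining nodes (acyclicity).
-- In a circuit of type Circ V (suc k) the root is node `zero`; size = suc k.
data Circ (V : Set) : ℕ → Set where
  []  : Circ V 0
  _◁_ : {k : ℕ} → Gate V k → Circ V k → Circ V (suc k)

infixr 5 _◁_

labelVal : {V : Set} → (V → Bool) → Label V → Bool
labelVal σ (lit l)   = litVal σ l
labelVal σ (const b) = b

gateVal : {V : Set} {k : ℕ} → (V → Bool) → Vec Bool k → Gate V k → Bool
gateVal σ vs (leaf l)  = labelVal σ l
gateVal σ vs (and i j) = lookup vs i ∧ lookup vs j
gateVal σ vs (or i j)  = lookup vs i ∨ lookup vs j

vals : {V : Set} {k : ℕ} → (V → Bool) → Circ V k → Vec Bool k
vals σ []      = []
vals σ (g ◁ c) = let vs = vals σ c in gateVal σ vs g ∷ vs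

eval : {V : Set} {k : ℕ} → (V → Bool) → Circ V (suc k) → Bool
eval σ c = head (vals σ c)

labelAt : {V : Set} {k : ℕ} → Circ V k → Fin k → Maybe (Label V)
labelAt (leaf l ◁ c)  zero    = just l
labelAt (and _ _ ◁ c) zero    = nothing
labelAt (or _ _ ◁ c)  zero    = nothing
labelAt (g ◁ c)       (suc i) = labelAt c i

IsChild : {V : Set} {k : ℕ} → Gate V k → Fin k → Set
IsChild (leaf _)  j = ⊥
IsChild (and l r) j = j ≡ l ⊎ j ≡ r
IsChild (or l r)  j = j ≡ l ⊎ j ≡ r

Child : {V : Set} {k : ℕ} → Circ V k → Fin k → Fin k → Set
Child (g ◁ c) zero    zero    = ⊥
Child (g ◁ c) zero    (suc j) = IsChild g j
Child (g ◁ c) (suc i) zero    = ⊥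
Child (g ◁ c) (suc i) (suc j) = Child c i j

AllDescendants : {V : Set} {k : ℕ} → Circ V (suc k) → Set
AllDescendants {k = k} c = (j : Fin (suc k)) → Star (Child c) zero j

relabel : {V : Set} {k : ℕ} → (Fin k → Label V → Label V) → Circ V k → Circ V k
relabel f []              = []
relabel f (leaf l ◁ c)    = leaf (f zero l) ◁ relabel (λ i → f (suc i)) c
relabel f (and i j ◁ c)   = and i j ◁ relabel (λ i → f (suc i)) c
relabel f (or i j ◁ c)    = or i j ◁ relabel (λ i → f (suc i)) c

relabelSet : {V : Set} {k : ℕ} → Subset k → Bool → Circ V k → Circ V k
relabelSet L b = relabel (λ i l → if lookup L i then const b else l)

module LitNotions {V : Set} (_≟ᵥ_ : DecidableEquality V) where

  litEq : Lit V → Lit V → Bool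
  litEq (pos u) (pos v) = ⌊ u ≟ᵥ v ⌋
  litEq (neg u) (neg v) = ⌊ u ≟ᵥ v ⌋
  litEq _       _       = false

  isLitLabel : Lit V → Label V → Bool
  isLitLabel ℓ (lit m)   = litEq ℓ m
  isLitLabel ℓ (const _) = false

  substLit : {k : ℕ} → Lit V → Bool → Bool → Circ V k → Circ V k
  substLit ℓ a b = relabel (λ i l →
    if isLitLabel ℓ l then const a
    else if isLitLabel (negLit ℓ) l then const b else l)

  -- ℓ is ∧-realizable in G: some assignment σ of the other variables makes
  -- [[G|_{ℓ=w,¬ℓ=w'}]]_σ equal to [[w ∧ w']] as a function of the fresh w, w'.
  -- (σ also assigns v_ℓ, but no leaf of G|_{ℓ=w,¬ℓ=w'} mentions v_ℓ.)
  AndRealizable : {k : ℕ} → Circ V (suc k) → Lit V → Set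
  AndRealizable G ℓ =
    Σ (V → Bool) λ σ → (w w' : Bool) → eval σ (substLit ℓ w w' G) ≡ (w ∧ w')

  -- S (a set of ℓ-leaves) is ∧-unrealizable in G:
  -- ℓ is ∧-unrealizable in G|_{S' \ S : ⊥}, S' = all ℓ-leaves
  killOthers : {k : ℕ} → Lit V → Subset k → Circ V k → Circ V k
  killOthers ℓ S = relabel (λ i l →
    if isLitLabel ℓ l ∧ not (lookup S i) then const false else l)

  SetAndUnrealizable : {k : ℕ} → Circ V (suc k) → Lit V → Subset (suc k) → Set
  SetAndUnrealizable G ℓ S = ¬ AndRealizable (killOthers ℓ S G) ℓ

  LeavesOf : {k : ℕ} → Circ V k → Lit V → Subset k → Set
  LeavesOf {k} G ℓ S = (i : Fin k) → lookup S i ≡ true → labelAt G i ≡ just (lit ℓ)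

  Disjoint : {k : ℕ} → Subset k → Subset k → Set
  Disjoint {k} S T = (i : Fin k) → ¬ (lookup S i ≡ true × lookup T i ≡ true)

  setAllTrue : {k : ℕ} → List (Lit V × Subset k) → Circ V k → Circ V k
  setAllTrue []             G = G
  setAllTrue ((_ , S) ∷ Ss) G = setAllTrue Ss (relabelSet S true G)

  UnrealChain : {k : ℕ} → Circ V (suc k) → List (Lit V × Subset (suc k)) → Set
  UnrealChain G []             = ⊤
  UnrealChain G ((ℓ , S) ∷ Ss) =
    SetAndUnrealizable G ℓ S × UnrealChain (relabelSet S true G) Ss

  IndependentOf : (V → Set) → ((V → Bool) → Bool) → Set
  IndependentOf X f = (σ σ' : V → Bool) → ((v : V) → ¬ X v → σ v ≡ σ' v) → f σ ≡ f σ'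

  -- G is in SAUNF w.r.t. the variable set X and the sequence Ss = (S_1,…,S_k);
  -- each S_j is paired with the literal ℓ_j (over X) witnessing its literal-consistency.
  SAUNF : {k : ℕ} → (V → Set) → Circ V (suc k) → List (Lit V × Subset (suc k)) → Set
  SAUNF X G Ss =
    Ss ≢ []
    × AllPairs (λ p q → Disjoint (proj₂ p) (proj₂ q)) Ss
    × All (λ p → X (litVar (proj₁ p)) × LeavesOf G (proj₁ p) (proj₂ p)) Ss
    × UnrealChain G Ss
    × IndependentOf X (λ σ → eval σ (setAllTrue Ss G))

-- unsigned integer value of a bit sequence, bit `zero` least significant
bitsVal : {m : ℕ} → (Fin m → Bool) → ℕ
bitsVal {zero}  b = 0
bitsVal {suc m} b = (if b zero then 1 else 0) + 2 * bitsVal (λ i → b (suc i))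

data Var (n : ℕ) : Set where
  xv : Fin n → Var n
  yv : Fin n → Var n
  iv : Fin (n + n) → Var n

_≟Var_ : {n : ℕ} → DecidableEquality (Var n)
xv a ≟Var xv b with a FinP.≟ b
... | yes refl = yes refl
... | no ne    = no λ { refl → ne refl }
yv a ≟Var yv b with a FinP.≟ b
... | yes refl = yes refl
... | no ne    = no λ { refl → ne refl }
iv a ≟Var iv b with a FinP.≟ b
... | yes refl = yes refl
... | no ne    = no λ { refl → ne refl }
xv _ ≟Var yv _ = no λ ()
xv _ ≟Var iv _ = no λ ()
yv _ ≟Var xv _ = no λ ()
yv _ ≟Var iv _ = no λ ()
iv _ ≟Var xv _ = no λ ()
iv _ ≟Var yv _ = no λ ()

IsX : {n : ℕ} → Var n → Set
IsX (xv _) = ⊤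
IsX (yv _) = ⊥
IsX (iv _) = ⊥

valX valY valI : {n : ℕ} → (Var n → Bool) → ℕ
valX σ = bitsVal (λ i → σ (xv i))
valY σ = bitsVal (λ i → σ (yv i))
valI σ = bitsVal (λ i → σ (iv i))

divSpec : {n : ℕ} → (Var n → Bool) → Bool
divSpec σ = (valI σ % 2 ≡ᵇ 1) ∧ (valY σ % 2 ≡ᵇ 1) ∧ (valX σ * valY σ ≡ᵇ valI σ)

Represents : {V : Set} {k : ℕ} → Circ V (suc k) → ((V → Bool) → Bool) → Set
Represents G f = (σ : _) → eval σ G ≡ f σ

SAUNFVar : {n k : ℕ} → (Var n → Set) → Circ (Var n) (suc k) → List (Lit (Var n) × Subset (suc k)) → Set
SAUNFVar = LitNotions.SAUNF _≟Var_

-- For odd y, bit-serial 2-adic (Hensel) division of the low half of I by y computes the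
-- unique x < 2^n with x·y ≡ I (mod 2^n), together with the high half of x·y.  The circuit is
-- built from dual-rail gadgets (ripple adders, masks, equality tests) on the leaves of Y and
-- I, in O(n²) gates, and accepts iff I and Y are odd, the computed high half equals that of
-- I, and every x_a agrees with the computed quotient bit q_a via (x_a ∧ q_a) ∨ (¬x_a ∧ ¬q_a).
-- Each X-literal thus only occurs in such agreement gates.  Replacing x_a by w and ¬x_a by w'
-- never yields w ∧ w': at an input accepted for (w, w') = (⊤, ⊤), the value of q_a picks one
-- disjunct, which a choice with w ∧ w' = ⊥ still satisfies.  So the sets of x-leaves, one
-- literal at a time, are ∧-unrealizable, and once they are all set to ⊤ the agreement gates
-- are constantly true and the circuit no longer depends on X.

module Submission where

open import Defs
open import Data.Nat using (ℕ; zero; suc; _+_; _*_; _^_; _%_; _≡ᵇ_; _≤_; s≤s; z≤n)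
open import Data.Nat.Properties
  using (+-comm; *-comm; +-identityʳ; *-zeroʳ; *-cancelˡ-≡; +-cancelˡ-≡; suc-injective; even≢odd;
         ≡ᵇ⇒≡; ≡⇒≡ᵇ; m≤m+n; ≤-reflexive; ≤-trans)
open import Data.Nat.DivMod using ([m+kn]%n≡m%n)
open import Data.Nat.Tactic.RingSolver using (solve-∀)
open import Data.Fin using (Fin; zero; suc; _↑ˡ_; _↑ʳ_)
import Data.Fin.Properties as Fin
open import Data.Fin.Subset using (Subset)
open import Data.Bool using (Bool; true; false; _∧_; _∨_; not; _xor_; if_then_else_)
open import Data.Bool.Properties using (not-involutive; ∨-zeroʳ; ∧-identityʳ; ∧-assoc; T-≡; ⇔→≡)
open import Data.Maybe using (Maybe; just; nothing)
open import Data.Vec using (Vec; _∷_; []; head; tail; lookup; tabulate; replicate)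
open import Data.Vec.Properties using (tabulate-cong; lookup∘tabulate)
open import Data.List using (List; []; _∷_; map; _++_; allFin; _ʳ++_)
open import Data.List.Membership.Propositional using (_∈_)
open import Data.List.Membership.Propositional.Properties using (∈-map⁺; ∈-map⁻; ∈-++⁺ˡ; ∈-++⁺ʳ; ∈-allFin)
open import Data.List.Relation.Unary.Any using (here; there)
import Data.List.Relation.Unary.All as All
import Data.List.Relation.Unary.All.Properties as All
import Data.List.Relation.Unary.AllPairs as AllPairs
import Data.List.Relation.Unary.AllPairs.Properties as AllPairs
open import Data.List.Relation.Unary.Unique.Propositional using (Unique)
import Data.List.Relation.Unary.Unique.Propositional.Properties as Unique
open import Data.Product using (Σ; _×_; _,_; proj₁; proj₂; ∃-syntax)
open import Data.Sum using (_⊎_; inj₁; inj₂)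
open import Data.Empty using (⊥; ⊥-elim)
open import Data.Unit using (tt)
open import Function using (_∘_)
open import Function.Bundles using (Equivalence; mk⇔)
open import Relation.Nullary using (¬_; yes; no)
open import Relation.Nullary.Decidable using (⌊_⌋)
open import Relation.Binary.Definitions using (DecidableEquality)
open import Relation.Binary.PropositionalEquality
open import Relation.Binary.Construct.Closure.ReflexiveTransitive using (Star; ε; _◅_; gmap)

LabelValuation : Set → Set
LabelValuation V = Label V → Bool

double : ℕ → ℕ
double zero    = zero
double (suc k) = suc (suc (double k))

double≡ : ∀ k → double k ≡ 2 * k
double≡ zero    = refl
double≡ (suc k) rewrite double≡ k = step k
  where
  step : ∀ k → suc (suc (2 * k)) ≡ 2 * suc k
  step = solve-∀

module _ {V : Set} where

  gateValue : {k : ℕ} → LabelValuation V → Vec Bool k → Gate V k → Bool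
  gateValue ρ vs (leaf l)  = ρ l
  gateValue ρ vs (and i j) = lookup vs i ∧ lookup vs j
  gateValue ρ vs (or i j)  = lookup vs i ∨ lookup vs j

  nodeValues : {k : ℕ} → LabelValuation V → Circ V k → Vec Bool k
  nodeValues ρ []      = []
  nodeValues ρ (g ◁ c) = gateValue ρ (nodeValues ρ c) g ∷ nodeValues ρ c

  vals≡nodeValues : {k : ℕ} (σ : V → Bool) (c : Circ V k) → vals σ c ≡ nodeValues (labelVal σ) c
  vals≡nodeValues σ []            = refl
  vals≡nodeValues σ (leaf l ◁ c)  = cong (_ ∷_) (vals≡nodeValues σ c)
  vals≡nodeValues σ (and i j ◁ c) rewrite vals≡nodeValues σ c = refl
  vals≡nodeValues σ (or i j ◁ c)  rewrite vals≡nodeValues σ c = refl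

  nodeValues-relabel : {k : ℕ} (ρ : LabelValuation V) (r : Label V → Label V) (c : Circ V k) →
                       nodeValues ρ (relabel (λ _ → r) c) ≡ nodeValues (ρ ∘ r) c
  nodeValues-relabel ρ r []            = refl
  nodeValues-relabel ρ r (leaf l ◁ c)  = cong (_ ∷_) (nodeValues-relabel ρ r c)
  nodeValues-relabel ρ r (and i j ◁ c) rewrite nodeValues-relabel ρ r c = refl
  nodeValues-relabel ρ r (or i j ◁ c)  rewrite nodeValues-relabel ρ r c = refl

  relabel-∘ : {k : ℕ} (f g : Fin k → Label V → Label V) (c : Circ V k) →
              relabel f (relabel g c) ≡ relabel (λ i → f i ∘ g i) c
  relabel-∘ f g []            = refl
  relabel-∘ f g (leaf l ◁ c)  = cong (_ ◁_) (relabel-∘ (f ∘ suc) (g ∘ suc) c)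
  relabel-∘ f g (and i j ◁ c) = cong (_ ◁_) (relabel-∘ (f ∘ suc) (g ∘ suc) c)
  relabel-∘ f g (or i j ◁ c)  = cong (_ ◁_) (relabel-∘ (f ∘ suc) (g ∘ suc) c)

  relabel-cong : {k : ℕ} (f g : Fin k → Label V → Label V) (c : Circ V k) →
                 (∀ i l → labelAt c i ≡ just l → f i l ≡ g i l) → relabel f c ≡ relabel g c
  relabel-cong f g []            e = refl
  relabel-cong f g (leaf l ◁ c)  e = cong₂ (λ a b → leaf a ◁ b) (e zero l refl) (relabel-cong _ _ c (e ∘ suc))
  relabel-cong f g (and i j ◁ c) e = cong (_ ◁_) (relabel-cong _ _ c (e ∘ suc))
  relabel-cong f g (or i j ◁ c)  e = cong (_ ◁_) (relabel-cong _ _ c (e ∘ suc))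

  relabel-id : {k : ℕ} (c : Circ V k) → relabel (λ _ l → l) c ≡ c
  relabel-id []            = refl
  relabel-id (leaf l ◁ c)  = cong (_ ◁_) (relabel-id c)
  relabel-id (and i j ◁ c) = cong (_ ◁_) (relabel-id c)
  relabel-id (or i j ◁ c)  = cong (_ ◁_) (relabel-id c)

  -- Making every node reachable: below each copied gate sits an or-gate joining it to the
  -- rest of the spine, which ends in a ⊤ leaf; the whole spine therefore evaluates to true,
  -- and a root `p ∧ spine` computes node p while having every node as a descendant.

  mapGate : {k k' : ℕ} → (Fin k → Fin k') → Gate V k → Gate V k'
  mapGate h (leaf l)  = leaf l
  mapGate h (and i j) = and (h i) (h j)
  mapGate h (or i j)  = or (h i) (h j)

  spine : {k : ℕ} → Circ V k → Circ V (suc (double k))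
  embed : {k : ℕ} (c : Circ V k) → Fin k → Fin (suc (double k))
  spine []      = leaf (const true) ◁ []
  spine (g ◁ c) = or zero (suc zero) ◁ mapGate (embed c) g ◁ spine c
  embed (g ◁ c) zero    = suc zero
  embed (g ◁ c) (suc i) = suc (suc (embed c i))

  lookup-embed : {k : ℕ} (ρ : LabelValuation V) (c : Circ V k) (i : Fin k) →
                 lookup (nodeValues ρ (spine c)) (embed c i) ≡ lookup (nodeValues ρ c) i
  lookup-embed ρ (leaf l ◁ c)  zero    = refl
  lookup-embed ρ (and a b ◁ c) zero    = cong₂ _∧_ (lookup-embed ρ c a) (lookup-embed ρ c b)
  lookup-embed ρ (or a b ◁ c)  zero    = cong₂ _∨_ (lookup-embed ρ c a) (lookup-embed ρ c b)
  lookup-embed ρ (g ◁ c)       (suc i) = lookup-embed ρ c i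

  spine-true : {k : ℕ} (ρ : LabelValuation V) → ρ (const true) ≡ true → (c : Circ V k) →
               lookup (nodeValues ρ (spine c)) zero ≡ true
  spine-true ρ ρ⊤ []      = ρ⊤
  spine-true ρ ρ⊤ (g ◁ c) rewrite spine-true ρ ρ⊤ c = ∨-zeroʳ _

  Star-suc : {k : ℕ} {g : Gate V k} {c : Circ V k} {i j : Fin k} →
             Star (Child c) i j → Star (Child (g ◁ c)) (suc i) (suc j)
  Star-suc = gmap suc (λ x → x)

  spine-reachable : {k : ℕ} (c : Circ V k) (j : Fin (suc (double k))) → Star (Child (spine c)) zero j
  spine-reachable []      zero          = ε
  spine-reachable (g ◁ c) zero          = ε
  spine-reachable (g ◁ c) (suc zero)    = inj₁ refl ◅ ε
  spine-reachable (g ◁ c) (suc (suc j)) = inj₂ refl ◅ Star-suc (Star-suc (spine-reachable c j))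

  rootAt : {k : ℕ} (c : Circ V k) → Fin k → Circ V (suc (suc (double k)))
  rootAt c p = and (embed c p) zero ◁ spine c

  rootAt-allDescendants : {k : ℕ} (c : Circ V k) (p : Fin k) → AllDescendants (rootAt c p)
  rootAt-allDescendants c p zero    = ε
  rootAt-allDescendants c p (suc j) = inj₂ refl ◅ Star-suc (spine-reachable c j)

  rootAt-value : {k : ℕ} (c : Circ V k) (p : Fin k) (ρ : LabelValuation V) → ρ (const true) ≡ true →
                 lookup (nodeValues ρ (rootAt c p)) zero ≡ lookup (nodeValues ρ c) p
  rootAt-value c p ρ ρ⊤ rewrite lookup-embed ρ c p | spine-true ρ ρ⊤ c = ∧-identityʳ _

-- Bit vectors are least significant bit first.  The operations below use head/tail
-- rather than pattern matching on the vector, so that they unfold on vectors that are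
-- not syntactically conses (such as vectors of node values under a valuation).

maj : Bool → Bool → Bool → Bool
maj a b c = (a ∧ b) ∨ (c ∧ (a xor b))

add : {m : ℕ} → Bool → Vec Bool m → Vec Bool m → Vec Bool m × Bool
add {zero}  c a b = [] , c
add {suc m} c a b =
  let (s , c') = add (maj (head a) (head b) c) (tail a) (tail b)
  in ((head a xor head b) xor c) ∷ s , c'

mask : {m : ℕ} → Bool → Vec Bool m → Vec Bool m
mask {zero}  g v = []
mask {suc m} g v = (g ∧ head v) ∷ mask g (tail v)

snoc : {m : ℕ} → Vec Bool m → Bool → Vec Bool (suc m)
snoc {zero}  v x = x ∷ []
snoc {suc m} v x = head v ∷ snoc (tail v) x

quotientBit : {m : ℕ} → Bool → Vec Bool (suc m) → Bool
quotientBit i u = i xor head u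

shiftAdd : {m : ℕ} → Bool → Vec Bool (suc m) → Vec Bool (suc m) → Vec Bool (suc m)
shiftAdd i u y =
  let (s , c) = add false u (mask (quotientBit i u) y)
  in snoc (tail s) c

-- Bit-serial division by an odd y modulo 2^j (Hensel lifting): each quotient bit is chosen
-- so that the low bit of u + q·y equals the next dividend bit, and that bit is shifted out.
divide : {j m : ℕ} → Vec Bool j → Vec Bool (suc m) → Vec Bool (suc m) → Vec Bool j × Vec Bool (suc m)
divide {zero}  is u y = [] , u
divide {suc j} is u y =
  let (qs , r) = divide (tail is) (shiftAdd (head is) u y) y
  in quotientBit (head is) u ∷ qs , r

equal : {m : ℕ} → Vec Bool m → Vec Bool m → Bool
equal {zero}  a b = true
equal {suc m} a b = not (head a xor head b) ∧ equal (tail a) (tail b)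

agree : Bool → Bool → Bool → Bool
agree p q g = (p ∧ g) ∨ (q ∧ not g)

allAgree : {m : ℕ} → Vec Bool m → Vec Bool m → Vec Bool m → Bool
allAgree {zero}  ps qs gs = true
allAgree {suc m} ps qs gs = agree (head ps) (head qs) (head gs) ∧ allAgree (tail ps) (tail qs) (tail gs)

not-∧ : ∀ a b → (not a ∨ not b) ≡ not (a ∧ b)
not-∧ true  b = refl
not-∧ false b = refl

not-∨ : ∀ a b → (not a ∧ not b) ≡ not (a ∨ b)
not-∨ true  b = refl
not-∨ false b = refl

xor-∨ : ∀ a b → ((a ∧ not b) ∨ (not a ∧ b)) ≡ (a xor b)
xor-∨ true  true  = refl
xor-∨ true  false = refl
xor-∨ false b     = refl

literalsCost : ℕ → ℕ
literalsCost zero    = 0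
literalsCost (suc j) = literalsCost j + 2

addCost : ℕ → ℕ
addCost zero    = 0
addCost (suc j) = addCost j + 18

maskCost : ℕ → ℕ
maskCost zero    = 0
maskCost (suc j) = maskCost j + 2

shiftAddCost : ℕ → ℕ
shiftAddCost m = addCost (suc m) + maskCost (suc m) + 6

divideCost : ℕ → ℕ → ℕ
divideCost zero    m = 0
divideCost (suc j) m = divideCost j m + shiftAddCost m

equalCost : ℕ → ℕ
equalCost zero    = 2
equalCost (suc j) = 2 + equalCost j + 6

allAgreeCost : ℕ → ℕ
allAgreeCost zero    = 1
allAgreeCost (suc j) = 1 + allAgreeCost j + 5

literalsCost≡ : ∀ j → literalsCost j ≡ 2 * j
literalsCost≡ zero    = refl
literalsCost≡ (suc j) rewrite literalsCost≡ j = step j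
  where
  step : ∀ j → 2 * j + 2 ≡ 2 * suc j
  step = solve-∀

addCost≡ : ∀ j → addCost j ≡ 18 * j
addCost≡ zero    = refl
addCost≡ (suc j) rewrite addCost≡ j = step j
  where
  step : ∀ j → 18 * j + 18 ≡ 18 * suc j
  step = solve-∀

maskCost≡ : ∀ j → maskCost j ≡ 2 * j
maskCost≡ zero    = refl
maskCost≡ (suc j) rewrite maskCost≡ j = step j
  where
  step : ∀ j → 2 * j + 2 ≡ 2 * suc j
  step = solve-∀

shiftAddCost≡ : ∀ m → shiftAddCost m ≡ 20 * suc m + 6
shiftAddCost≡ m rewrite addCost≡ (suc m) | maskCost≡ (suc m) = collect m
  where
  collect : ∀ m → 18 * suc m + 2 * suc m + 6 ≡ 20 * suc m + 6
  collect = solve-∀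

divideCost≡ : ∀ j m → divideCost j m ≡ j * (20 * suc m + 6)
divideCost≡ zero    m = refl
divideCost≡ (suc j) m rewrite divideCost≡ j m | shiftAddCost≡ m = step j m
  where
  step : ∀ j m → j * (20 * suc m + 6) + (20 * suc m + 6) ≡ suc j * (20 * suc m + 6)
  step = solve-∀

equalCost≡ : ∀ j → equalCost j ≡ 8 * j + 2
equalCost≡ zero    = refl
equalCost≡ (suc j) rewrite equalCost≡ j = step j
  where
  step : ∀ j → 2 + (8 * j + 2) + 6 ≡ 8 * suc j + 2
  step = solve-∀

allAgreeCost≡ : ∀ j → allAgreeCost j ≡ 6 * j + 1
allAgreeCost≡ zero    = refl
allAgreeCost≡ (suc j) rewrite allAgreeCost≡ j = step j
  where
  step : ∀ j → 1 + (6 * j + 1) + 5 ≡ 6 * suc j + 1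
  step = solve-∀

-- Circuits are built incrementally: a node "computes" f if its value equals f on every
-- label valuation satisfying Good, and every intermediate Boolean is kept in dual rail
-- (a node for it and a node for its negation), since NNF has no negation gates.
module Builder {V : Set} (Good : LabelValuation V → Set)
               (good-const : ∀ {ρ} → Good ρ → ∀ b → ρ (const b) ≡ b) where

  Sem : Set
  Sem = LabelValuation V → Bool

  data _⊑[_]_ {k : ℕ} (c : Circ V k) : ℕ → {k' : ℕ} → Circ V k' → Set where
    ⊑-refl : c ⊑[ 0 ] c
    ⊑-step : {m k' : ℕ} {c' : Circ V k'} (g : Gate V k') → c ⊑[ m ] c' → c ⊑[ suc m ] (g ◁ c')

  private variable
    k k' k'' m m₁ m₂ : ℕ
    c : Circ V k
    c' : Circ V k'
    c'' : Circ V k''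
    f g : Sem

  weakenIndex : {c : Circ V k} {c' : Circ V k'} → c ⊑[ m ] c' → Fin k → Fin k'
  weakenIndex ⊑-refl       i = i
  weakenIndex (⊑-step g e) i = suc (weakenIndex e i)

  lookup-weakenIndex : {c : Circ V k} {c' : Circ V k'} (e : c ⊑[ m ] c') (ρ : LabelValuation V) (i : Fin k) →
                       lookup (nodeValues ρ c') (weakenIndex e i) ≡ lookup (nodeValues ρ c) i
  lookup-weakenIndex ⊑-refl       ρ i = refl
  lookup-weakenIndex (⊑-step g e) ρ i = lookup-weakenIndex e ρ i

  ⊑-trans : c ⊑[ m₁ ] c' → c' ⊑[ m₂ ] c'' → c ⊑[ m₂ + m₁ ] c''
  ⊑-trans e ⊑-refl        = e
  ⊑-trans e (⊑-step g e') = ⊑-step g (⊑-trans e e')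

  ⊑-size : {c : Circ V k} {c' : Circ V k'} → c ⊑[ m ] c' → k' ≡ m + k
  ⊑-size ⊑-refl       = refl
  ⊑-size (⊑-step g e) = cong suc (⊑-size e)

  record Node (c : Circ V k) (f : Sem) : Set where
    constructor node
    field
      index    : Fin k
      computes : ∀ ρ → Good ρ → lookup (nodeValues ρ c) index ≡ f ρ
  open Node public

  weaken : c ⊑[ m ] c' → Node c f → Node c' f
  weaken e (node i p) = node (weakenIndex e i) (λ ρ γ → trans (lookup-weakenIndex e ρ i) (p ρ γ))

  cast : (∀ ρ → f ρ ≡ g ρ) → Node c f → Node c g
  cast f≡g (node i p) = node i (λ ρ γ → trans (p ρ γ) (f≡g ρ))

  Dual : Circ V k → Sem → Set
  Dual c f = Node c f × Node c (not ∘ f)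

  weakenᴰ : c ⊑[ m ] c' → Dual c f → Dual c' f
  weakenᴰ e (p , n) = weaken e p , weaken e n

  castᴰ : (∀ ρ → f ρ ≡ g ρ) → Dual c f → Dual c g
  castᴰ f≡g (p , n) = cast f≡g p , cast (cong not ∘ f≡g) n

  notᴰ : Dual c f → Dual c (not ∘ f)
  notᴰ (p , n) = n , cast (λ ρ → sym (not-involutive _)) p

  data Duals (c : Circ V k) : {j : ℕ} → (LabelValuation V → Vec Bool j) → Set where
    []  : {F : LabelValuation V → Vec Bool 0} → Duals c F
    _∷_ : {j : ℕ} {F : LabelValuation V → Vec Bool (suc j)} →
          Dual c (head ∘ F) → Duals c (tail ∘ F) → Duals c F

  weakenⱽ : c ⊑[ m ] c' → {j : ℕ} {F : LabelValuation V → Vec Bool j} → Duals c F → Duals c' F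
  weakenⱽ e []       = []
  weakenⱽ e (d ∷ ds) = weakenᴰ e d ∷ weakenⱽ e ds

  headⱽ : {j : ℕ} {F : LabelValuation V → Vec Bool (suc j)} → Duals c F → Dual c (head ∘ F)
  headⱽ (d ∷ ds) = d

  tailⱽ : {j : ℕ} {F : LabelValuation V → Vec Bool (suc j)} → Duals c F → Duals c (tail ∘ F)
  tailⱽ (d ∷ ds) = ds

  record Build (c : Circ V k) (m : ℕ) (P : {k' : ℕ} → Circ V k' → Set) : Set where
    constructor build
    field
      {size}  : ℕ
      circuit : Circ V size
      extends : c ⊑[ m ] circuit
      result  : P circuit

  private variable
    P Q : {k' : ℕ} → Circ V k' → Set

  return : P c → Build c 0 P
  return {c = c} p = build c ⊑-refl p

  _>>=_ : Build c m₁ P → ({k' : ℕ} {c' : Circ V k'} → c ⊑[ m₁ ] c' → P c' → Build c' m₂ Q) →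
          Build c (m₂ + m₁) Q
  build c₁ e₁ p >>= κ with κ e₁ p
  ... | build c₂ e₂ q = build c₂ (⊑-trans e₁ e₂) q
  infixl 1 _>>=_

  andGate : Node c f → Node c g → Build c 1 (λ c' → Node c' (λ ρ → f ρ ∧ g ρ))
  andGate {c = c} (node i p) (node j q) =
    build (and i j ◁ c) (⊑-step _ ⊑-refl) (node zero (λ ρ γ → cong₂ _∧_ (p ρ γ) (q ρ γ)))

  orGate : Node c f → Node c g → Build c 1 (λ c' → Node c' (λ ρ → f ρ ∨ g ρ))
  orGate {c = c} (node i p) (node j q) =
    build (or i j ◁ c) (⊑-step _ ⊑-refl) (node zero (λ ρ γ → cong₂ _∨_ (p ρ γ) (q ρ γ)))

  leafGate : (l : Label V) → Build c 1 (λ c' → Node c' (λ ρ → ρ l))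
  leafGate {c = c} l = build (leaf l ◁ c) (⊑-step _ ⊑-refl) (node zero (λ ρ γ → refl))

  andᴰ : Dual c f → Dual c g → Build c 2 (λ c' → Dual c' (λ ρ → f ρ ∧ g ρ))
  andᴰ {f = f} {g = g} (fp , fn) (gp , gn) =
    andGate fp gp >>= λ e₁ p →
    orGate (weaken e₁ fn) (weaken e₁ gn) >>= λ e₂ n →
    return (weaken e₂ p , cast (λ ρ → not-∧ (f ρ) (g ρ)) n)

  orᴰ : Dual c f → Dual c g → Build c 2 (λ c' → Dual c' (λ ρ → f ρ ∨ g ρ))
  orᴰ {f = f} {g = g} (fp , fn) (gp , gn) =
    orGate fp gp >>= λ e₁ p →
    andGate (weaken e₁ fn) (weaken e₁ gn) >>= λ e₂ n →
    return (weaken e₂ p , cast (λ ρ → not-∨ (f ρ) (g ρ)) n)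

  xorᴰ : Dual c f → Dual c g → Build c 6 (λ c' → Dual c' (λ ρ → f ρ xor g ρ))
  xorᴰ {f = f} {g = g} F G =
    andᴰ F (notᴰ G) >>= λ e₁ u →
    andᴰ (weakenᴰ e₁ (notᴰ F)) (weakenᴰ e₁ G) >>= λ e₂ v →
    orᴰ (weakenᴰ e₂ u) v >>= λ e₃ w →
    return (castᴰ (λ ρ → xor-∨ (f ρ) (g ρ)) w)

  constᴰ : (b : Bool) → Build c 2 (λ c' → Dual c' (λ _ → b))
  constᴰ b =
    leafGate (const b) >>= λ e₁ p →
    leafGate (const (not b)) >>= λ e₂ n →
    return (weaken e₂ (node (index p) (λ ρ γ → trans (computes p ρ γ) (good-const γ b))) ,
            node (index n) (λ ρ γ → trans (computes n ρ γ) (good-const γ (not b))))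

  literalᴰ : (v : V) → (∀ ρ → Good ρ → ρ (lit (neg v)) ≡ not (ρ (lit (pos v)))) →
             Build c 2 (λ c' → Dual c' (λ ρ → ρ (lit (pos v))))
  literalᴰ v complement =
    leafGate (lit (pos v)) >>= λ e₁ p →
    leafGate (lit (neg v)) >>= λ e₂ n →
    return (weaken e₂ p , node (index n) (λ ρ γ → trans (computes n ρ γ) (complement ρ γ)))

  literalsᴰ : {j : ℕ} (h : Fin j → V) → (∀ a ρ → Good ρ → ρ (lit (neg (h a))) ≡ not (ρ (lit (pos (h a))))) →
              Build c (literalsCost j) (λ c' → Duals c' (λ ρ → tabulate (λ a → ρ (lit (pos (h a))))))
  literalsᴰ {j = zero}  h complement = return []
  literalsᴰ {j = suc j} h complement =
    literalᴰ (h zero) (complement zero) >>= λ e₁ d →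
    literalsᴰ (h ∘ suc) (complement ∘ suc) >>= λ e₂ ds →
    return (weakenᴰ e₂ d ∷ ds)

  fullAdderᴰ : {a b c₀ : Sem} → Dual c a → Dual c b → Dual c c₀ →
               Build c 18 (λ c' → Dual c' (λ ρ → (a ρ xor b ρ) xor c₀ ρ) × Dual c' (λ ρ → maj (a ρ) (b ρ) (c₀ ρ)))
  fullAdderᴰ A B C =
    xorᴰ A B >>= λ e₁ t →
    xorᴰ t (weakenᴰ e₁ C) >>= λ e₂ s →
    andᴰ (weakenᴰ e₂ (weakenᴰ e₁ A)) (weakenᴰ e₂ (weakenᴰ e₁ B)) >>= λ e₃ u →
    andᴰ (weakenᴰ e₃ (weakenᴰ e₂ (weakenᴰ e₁ C))) (weakenᴰ e₃ (weakenᴰ e₂ t)) >>= λ e₄ v →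
    orᴰ (weakenᴰ e₄ u) v >>= λ e₅ carry →
    return (weakenᴰ e₅ (weakenᴰ e₄ (weakenᴰ e₃ s)) , carry)

  addᴰ : {j : ℕ} {c₀ : Sem} {A B : LabelValuation V → Vec Bool j} → Dual c c₀ → Duals c A → Duals c B →
         Build c (addCost j) (λ c' → Duals c' (λ ρ → proj₁ (add (c₀ ρ) (A ρ) (B ρ)))
                                   × Dual c' (λ ρ → proj₂ (add (c₀ ρ) (A ρ) (B ρ))))
  addᴰ C [] [] = return ([] , C)
  addᴰ C (a ∷ as) (b ∷ bs) =
    fullAdderᴰ a b C >>= λ e₁ (s , carry) →
    addᴰ carry (weakenⱽ e₁ as) (weakenⱽ e₁ bs) >>= λ e₂ (ss , carryOut) →
    return (weakenᴰ e₂ s ∷ ss , carryOut)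

  maskᴰ : {j : ℕ} {Y : LabelValuation V → Vec Bool j} → Dual c g → Duals c Y →
          Build c (maskCost j) (λ c' → Duals c' (λ ρ → mask (g ρ) (Y ρ)))
  maskᴰ G []       = return []
  maskᴰ G (y ∷ ys) =
    andᴰ G y >>= λ e₁ d →
    maskᴰ (weakenᴰ e₁ G) (weakenⱽ e₁ ys) >>= λ e₂ ds →
    return (weakenᴰ e₂ d ∷ ds)

  snocᴰ : {j : ℕ} {F : LabelValuation V → Vec Bool j} → Duals c F → Dual c f → Duals c (λ ρ → snoc (F ρ) (f ρ))
  snocᴰ []       d = d ∷ []
  snocᴰ (x ∷ xs) d = x ∷ snocᴰ xs d

  replicateᴰ : {j : ℕ} → Dual c f → Duals c (λ ρ → replicate j (f ρ))
  replicateᴰ {j = zero}  d = []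
  replicateᴰ {j = suc j} d = d ∷ replicateᴰ d

  shiftAddᴰ : {m : ℕ} {i : Sem} {U Y : LabelValuation V → Vec Bool (suc m)} →
              Dual c i → Duals c U → Duals c Y → Dual c (λ _ → false) →
              Build c (shiftAddCost m) (λ c' → Dual c' (λ ρ → quotientBit (i ρ) (U ρ))
                                             × Duals c' (λ ρ → shiftAdd (i ρ) (U ρ) (Y ρ)))
  shiftAddᴰ I U Y off =
    xorᴰ I (headⱽ U) >>= λ e₁ q →
    maskᴰ q (weakenⱽ e₁ Y) >>= λ e₂ qy →
    addᴰ (weakenᴰ e₂ (weakenᴰ e₁ off)) (weakenⱽ e₂ (weakenⱽ e₁ U)) qy >>= λ e₃ (s , carry) →
    return (weakenᴰ e₃ (weakenᴰ e₂ q) , snocᴰ (tailⱽ s) carry)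

  divideᴰ : {j m : ℕ} {Is : LabelValuation V → Vec Bool j} {U Y : LabelValuation V → Vec Bool (suc m)} →
            Duals c Is → Duals c U → Duals c Y → Dual c (λ _ → false) →
            Build c (divideCost j m) (λ c' → Duals c' (λ ρ → proj₁ (divide (Is ρ) (U ρ) (Y ρ)))
                                           × Duals c' (λ ρ → proj₂ (divide (Is ρ) (U ρ) (Y ρ))))
  divideᴰ []       U Y off = return ([] , U)
  divideᴰ (i ∷ is) U Y off =
    shiftAddᴰ i U Y off >>= λ e₁ (q , U') →
    divideᴰ (weakenⱽ e₁ is) U' (weakenⱽ e₁ Y) (weakenᴰ e₁ off) >>= λ e₂ (qs , R) →
    return (weakenᴰ e₂ q ∷ qs , R)

  equalᴰ : {j : ℕ} {A B : LabelValuation V → Vec Bool j} → Duals c A → Duals c B →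
           Build c (equalCost j) (λ c' → Dual c' (λ ρ → equal (A ρ) (B ρ)))
  equalᴰ []       []       = constᴰ true
  equalᴰ (a ∷ as) (b ∷ bs) =
    xorᴰ a b >>= λ e₁ d →
    equalᴰ (weakenⱽ e₁ as) (weakenⱽ e₁ bs) >>= λ e₂ rest →
    andᴰ (weakenᴰ e₂ (notᴰ d)) rest

  agreeᴺ : (v : V) → Dual c g → Build c 5 (λ c' → Node c' (λ ρ → agree (ρ (lit (pos v))) (ρ (lit (neg v))) (g ρ)))
  agreeᴺ v (gp , gn) =
    leafGate (lit (pos v)) >>= λ e₁ p →
    leafGate (lit (neg v)) >>= λ e₂ n →
    andGate (weaken e₂ p) (weaken e₂ (weaken e₁ gp)) >>= λ e₃ pg →
    andGate (weaken e₃ n) (weaken e₃ (weaken e₂ (weaken e₁ gn))) >>= λ e₄ ng →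
    orGate (weaken e₄ pg) ng

  allAgreeᴺ : {j : ℕ} (h : Fin j → V) {G : LabelValuation V → Vec Bool j} → Duals c G →
              Build c (allAgreeCost j) (λ c' → Node c' (λ ρ → allAgree (tabulate (λ a → ρ (lit (pos (h a)))))
                                                                   (tabulate (λ a → ρ (lit (neg (h a)))))
                                                                   (G ρ)))
  allAgreeᴺ h [] =
    leafGate (const true) >>= λ e₁ t →
    return (node (index t) (λ ρ γ → trans (computes t ρ γ) (good-const γ true)))
  allAgreeᴺ h (g ∷ gs) =
    agreeᴺ (h zero) g >>= λ e₁ first →
    allAgreeᴺ (h ∘ suc) (weakenⱽ e₁ gs) >>= λ e₂ rest →
    andGate (weaken e₂ first) rest

bit : Bool → ℕ
bit b = if b then 1 else 0

value : {m : ℕ} → Vec Bool m → ℕ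
value {zero}  v = 0
value {suc m} v = bit (head v) + 2 * value (tail v)

bitsVal≡value : {m : ℕ} (f : Fin m → Bool) → bitsVal f ≡ value (tabulate f)
bitsVal≡value {zero}  f = refl
bitsVal≡value {suc m} f = cong (λ v → bit (f zero) + 2 * v) (bitsVal≡value (f ∘ suc))

bitsVal-++ : (a b : ℕ) (f : Fin (a + b) → Bool) →
             bitsVal f ≡ bitsVal (λ j → f (j ↑ˡ b)) + 2 ^ a * bitsVal (λ j → f (a ↑ʳ j))
bitsVal-++ zero    b f = sym (+-identityʳ _)
bitsVal-++ (suc a) b f rewrite bitsVal-++ a b (f ∘ suc) =
  shift (bit (f zero)) (bitsVal (λ j → f (suc (j ↑ˡ b)))) (2 ^ a) (bitsVal (λ j → f (suc (a ↑ʳ j))))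
  where
  shift : ∀ h l p u → h + 2 * (l + p * u) ≡ (h + 2 * l) + 2 * p * u
  shift = solve-∀

∧-true : ∀ {a b} → a ∧ b ≡ true → a ≡ true × b ≡ true
∧-true {true} {true} e = refl , refl

≡ᵇ-true⇒≡ : ∀ {a b} → (a ≡ᵇ b) ≡ true → a ≡ b
≡ᵇ-true⇒≡ {a} {b} e = ≡ᵇ⇒≡ a b (Equivalence.from T-≡ e)

≡⇒≡ᵇ-true : ∀ {a b} → a ≡ b → (a ≡ᵇ b) ≡ true
≡⇒≡ᵇ-true {a} {b} e = Equivalence.to T-≡ (≡⇒≡ᵇ a b e)

bit+2*-injective : ∀ a b A B → bit a + 2 * A ≡ bit b + 2 * B → a ≡ b × A ≡ B
bit+2*-injective true  true  A B e = refl , *-cancelˡ-≡ A B 2 (suc-injective e)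
bit+2*-injective false false A B e = refl , *-cancelˡ-≡ A B 2 e
bit+2*-injective true  false A B e = ⊥-elim (even≢odd B A (sym e))
bit+2*-injective false true  A B e = ⊥-elim (even≢odd A B e)

value-injective : {m : ℕ} (a b : Vec Bool m) → value a ≡ value b → a ≡ b
value-injective []       []       e = refl
value-injective (x ∷ a) (y ∷ b) e =
  let x≡y , a≡b = bit+2*-injective x y (value a) (value b) e
  in cong₂ _∷_ x≡y (value-injective a b a≡b)

isOdd-bit : ∀ b A → ((bit b + 2 * A) % 2 ≡ᵇ 1) ≡ b
isOdd-bit b A = trans (cong (λ z → (bit b + z) % 2 ≡ᵇ 1) (*-comm' A))
                      (trans (cong (_≡ᵇ 1) ([m+kn]%n≡m%n (bit b) A 2)) (lemma b))
  where
  *-comm' : ∀ A → 2 * A ≡ A * 2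
  *-comm' = solve-∀
  lemma : ∀ b → (bit b % 2 ≡ᵇ 1) ≡ b
  lemma true  = refl
  lemma false = refl

full-adder-bits : ∀ a b c → bit ((a xor b) xor c) + 2 * bit (maj a b c) ≡ bit c + bit a + bit b
full-adder-bits true  true  true  = refl
full-adder-bits true  true  false = refl
full-adder-bits true  false true  = refl
full-adder-bits true  false false = refl
full-adder-bits false true  true  = refl
full-adder-bits false true  false = refl
full-adder-bits false false true  = refl
full-adder-bits false false false = refl

add-correct : {m : ℕ} (c : Bool) (a b : Vec Bool m) →
              value (proj₁ (add c a b)) + 2 ^ m * bit (proj₂ (add c a b)) ≡ bit c + value a + value b
add-correct {zero}  c a b = trans (+-identityʳ _) (sym (trans (+-identityʳ _) (+-identityʳ _)))
add-correct {suc m} c a b =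
  let c' = maj (head a) (head b) c
      s  = (head a xor head b) xor c
      S  = value (proj₁ (add c' (tail a) (tail b)))
      C  = bit (proj₂ (add c' (tail a) (tail b)))
      A  = value (tail a)
      B  = value (tail b)
  in begin
    bit s + 2 * S + (2 * 2 ^ m) * C          ≡⟨ factor (bit s) S (2 ^ m) C ⟩
    bit s + 2 * (S + 2 ^ m * C)              ≡⟨ cong (λ z → bit s + 2 * z) (add-correct c' (tail a) (tail b)) ⟩
    bit s + 2 * (bit c' + A + B)             ≡⟨ expand (bit s) (bit c') A B ⟩
    (bit s + 2 * bit c') + 2 * A + 2 * B     ≡⟨ cong (λ z → z + 2 * A + 2 * B) (full-adder-bits (head a) (head b) c) ⟩
    (bit c + bit (head a) + bit (head b)) + 2 * A + 2 * B ≡⟨ regroup (bit c) (bit (head a)) (bit (head b)) A B ⟩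
    bit c + value a + value b                ∎
  where
  open ≡-Reasoning
  factor : ∀ s S p C → s + 2 * S + (2 * p) * C ≡ s + 2 * (S + p * C)
  factor = solve-∀
  expand : ∀ s c A B → s + 2 * (c + A + B) ≡ (s + 2 * c) + 2 * A + 2 * B
  expand = solve-∀
  regroup : ∀ c a b A B → (c + a + b) + 2 * A + 2 * B ≡ c + (a + 2 * A) + (b + 2 * B)
  regroup = solve-∀

value-mask : {m : ℕ} (g : Bool) (y : Vec Bool m) → value (mask g y) ≡ bit g * value y
value-mask {zero}  g     y = sym (*-zeroʳ (bit g))
value-mask {suc m} true  y rewrite value-mask true (tail y) = unit (bit (head y)) (value (tail y))
  where
  unit : ∀ h t → h + 2 * (1 * t) ≡ 1 * (h + 2 * t)
  unit = solve-∀
value-mask {suc m} false y rewrite value-mask false (tail y) = refl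

value-snoc : {m : ℕ} (v : Vec Bool m) (x : Bool) → value (snoc v x) ≡ value v + 2 ^ m * bit x
value-snoc {zero}  v true  = refl
value-snoc {zero}  v false = refl
value-snoc {suc m} v x rewrite value-snoc (tail v) x = distrib (bit (head v)) (value (tail v)) (2 ^ m) (bit x)
  where
  distrib : ∀ h t p b → h + 2 * (t + p * b) ≡ h + 2 * t + 2 * p * b
  distrib = solve-∀

value-replicate-false : (m : ℕ) → value (replicate m false) ≡ 0
value-replicate-false zero    = refl
value-replicate-false (suc m) rewrite value-replicate-false m = refl

-- With y odd, the low bit of u + q·y is (head u) xor q, which is i by the choice of q.
shiftAdd-correct : {m : ℕ} (i : Bool) (u y : Vec Bool (suc m)) → head y ≡ true →
                   value u + bit (quotientBit i u) * value y ≡ bit i + 2 * value (shiftAdd i u y)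
shiftAdd-correct {m} i u y y-odd =
  let q = quotientBit i u
      S = add false u (mask q y)
      s = proj₁ S
      C = bit (proj₂ S)
  in begin
    value u + bit q * value y                 ≡⟨ cong (value u +_) (sym (value-mask q y)) ⟩
    bit false + value u + value (mask q y)    ≡⟨ sym (add-correct false u (mask q y)) ⟩
    value s + 2 ^ suc m * C                   ≡⟨ factor (bit (head s)) (value (tail s)) (2 ^ m) C ⟩
    bit (head s) + 2 * (value (tail s) + 2 ^ m * C)
      ≡⟨ cong₂ (λ a b → bit a + 2 * b) low-bit (sym (value-snoc (tail s) (proj₂ S))) ⟩
    bit i + 2 * value (shiftAdd i u y)        ∎
  where
  open ≡-Reasoning
  factor : ∀ h t p c → h + 2 * t + 2 * p * c ≡ h + 2 * (t + p * c)
  factor = solve-∀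
  low-bit-of : ∀ i u → ((u xor ((i xor u) ∧ true)) xor false) ≡ i
  low-bit-of true  true  = refl
  low-bit-of true  false = refl
  low-bit-of false true  = refl
  low-bit-of false false = refl
  low-bit : head (proj₁ (add false u (mask (quotientBit i u) y))) ≡ i
  low-bit rewrite y-odd = low-bit-of i (head u)

divide-correct : {j m : ℕ} (is : Vec Bool j) (u y : Vec Bool (suc m)) → head y ≡ true →
                 let (q , r) = divide is u y in value u + value y * value q ≡ 2 ^ j * value r + value is
divide-correct {zero}  is u y y-odd = pad (value u) (value y)
  where
  pad : ∀ u y → u + y * 0 ≡ 1 * u + 0
  pad = solve-∀
divide-correct {suc j} is u y y-odd =
  let i  = head is
      q  = quotientBit i u
      u' = shiftAdd i u y
      Q  = value (proj₁ (divide (tail is) u' y))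
      R  = value (proj₂ (divide (tail is) u' y))
      Y  = value y
  in begin
    value u + Y * (bit q + 2 * Q)            ≡⟨ split (value u) Y (bit q) Q ⟩
    (value u + bit q * Y) + 2 * (Y * Q)      ≡⟨ cong (λ z → z + 2 * (Y * Q)) (shiftAdd-correct i u y y-odd) ⟩
    (bit i + 2 * value u') + 2 * (Y * Q)     ≡⟨ join (bit i) (value u') (Y * Q) ⟩
    bit i + 2 * (value u' + Y * Q)           ≡⟨ cong (λ z → bit i + 2 * z) (divide-correct (tail is) u' y y-odd) ⟩
    bit i + 2 * (2 ^ j * R + value (tail is)) ≡⟨ rotate (bit i) (2 ^ j) R (value (tail is)) ⟩
    2 * 2 ^ j * R + (bit i + 2 * value (tail is)) ∎
  where
  open ≡-Reasoning
  split : ∀ u y g G → u + y * (g + 2 * G) ≡ (u + g * y) + 2 * (y * G)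
  split = solve-∀
  join : ∀ i u' yG → (i + 2 * u') + 2 * yG ≡ i + 2 * (u' + yG)
  join = solve-∀
  rotate : ∀ i p r l → i + 2 * (p * r + l) ≡ 2 * p * r + (i + 2 * l)
  rotate = solve-∀

odd-*-cancel : (t : ℕ) {j : ℕ} (x q : Vec Bool j) (A B : ℕ) →
               (1 + 2 * t) * value x + 2 ^ j * A ≡ (1 + 2 * t) * value q + 2 ^ j * B → x ≡ q × A ≡ B
odd-*-cancel t []      []      A B e = refl , drop (1 + 2 * t) A B e
  where
  drop : ∀ y A B → y * 0 + 1 * A ≡ y * 0 + 1 * B → A ≡ B
  drop y A B e = trans (sym (strip y A)) (trans e (strip y B))
    where
    strip : ∀ y A → y * 0 + 1 * A ≡ A
    strip = solve-∀
odd-*-cancel t {suc j} (a ∷ x) (b ∷ q) A B e =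
  let a≡b , rest = bit+2*-injective a b (high a x A) (high b q B)
                     (trans (sym (low-split t (bit a) (value x) (2 ^ j) A))
                            (trans e (low-split t (bit b) (value q) (2 ^ j) B)))
      x≡q , A≡B = odd-*-cancel t x q A B
                    (+-cancelˡ-≡ (t * bit b) _ _ (subst (λ c → high c x A ≡ high b q B) a≡b rest))
  in cong₂ _∷_ a≡b x≡q , A≡B
  where
  high : Bool → Vec Bool j → ℕ → ℕ
  high c v C = t * bit c + ((1 + 2 * t) * value v + 2 ^ j * C)
  low-split : ∀ t b X p A → (1 + 2 * t) * (b + 2 * X) + 2 * p * A ≡ b + 2 * (t * b + ((1 + 2 * t) * X + p * A))
  low-split = solve-∀

equal-sound : {m : ℕ} (a b : Vec Bool m) → equal a b ≡ true → a ≡ b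
equal-sound []            []            e = refl
equal-sound (true ∷ a)    (true ∷ b)    e = cong (true ∷_) (equal-sound a b e)
equal-sound (false ∷ a)   (false ∷ b)   e = cong (false ∷_) (equal-sound a b e)
equal-sound (true ∷ a)    (false ∷ b)   ()
equal-sound (false ∷ a)   (true ∷ b)    ()

equal-refl : {m : ℕ} (a : Vec Bool m) → equal a a ≡ true
equal-refl []          = refl
equal-refl (true ∷ a)  = equal-refl a
equal-refl (false ∷ a) = equal-refl a

allAgree-complement : {m : ℕ} (f : Fin m → Bool) (gs : Vec Bool m) →
                      allAgree (tabulate f) (tabulate (not ∘ f)) gs ≡ equal (tabulate f) gs
allAgree-complement {zero}  f gs = refl
allAgree-complement {suc m} f gs = cong₂ _∧_ (agree-complement (f zero) (head gs)) (allAgree-complement (f ∘ suc) (tail gs))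
  where
  agree-complement : ∀ a g → agree a (not a) g ≡ not (a xor g)
  agree-complement true  true  = refl
  agree-complement true  false = refl
  agree-complement false true  = refl
  agree-complement false false = refl

allAgree-update : {m : ℕ} (P N P' N' : Fin m → Bool) (gs : Vec Bool m) (j : Fin m) →
                  (∀ a → a ≢ j → P' a ≡ P a) → (∀ a → a ≢ j → N' a ≡ N a) →
                  agree (P' j) (N' j) (lookup gs j) ≡ true →
                  allAgree (tabulate P) (tabulate N) gs ≡ true → allAgree (tabulate P') (tabulate N') gs ≡ true
allAgree-update P N P' N' (g ∷ gs) zero P≈ N≈ agree-j all =
  cong₂ _∧_ agree-j (trans (cong₂ (λ ps ns → allAgree ps ns gs) (tabulate-cong (λ a → P≈ (suc a) λ ()))
                                                               (tabulate-cong (λ a → N≈ (suc a) λ ())))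
                           (proj₂ (∧-true all)))
allAgree-update P N P' N' (g ∷ gs) (suc j) P≈ N≈ agree-j all =
  cong₂ _∧_ (trans (cong₂ (λ p q → agree p q g) (P≈ zero λ ()) (N≈ zero λ ())) (proj₁ (∧-true all)))
            (allAgree-update (P ∘ suc) (N ∘ suc) (P' ∘ suc) (N' ∘ suc) gs j
                             (λ a a≢j → P≈ (suc a) (a≢j ∘ Fin.suc-injective)) (λ a a≢j → N≈ (suc a) (a≢j ∘ Fin.suc-injective))
                             agree-j (proj₂ (∧-true all)))

-- The core of ∧-unrealizability: only the j-th literal pair depends on (w, w'), and at some
-- point with w ∧ w' = false it satisfies whichever of its two agreement disjuncts is selected
-- by g_j, so the formula is true there, unlike w ∧ w'.
agreement-not-∧ : {m : ℕ} (v : Bool) (gs : Vec Bool m) (P N : Bool → Bool → Fin m → Bool) (j : Fin m) →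
  (∀ w w' a → a ≢ j → P w w' a ≡ P true true a) → (∀ w w' a → a ≢ j → N w w' a ≡ N true true a) →
  (w₁ w₁' : Bool) → w₁ ∧ w₁' ≡ false → P w₁ w₁' j ≡ true →
  (w₂ w₂' : Bool) → w₂ ∧ w₂' ≡ false → N w₂ w₂' j ≡ true →
  ¬ (∀ w w' → v ∧ allAgree (tabulate (P w w')) (tabulate (N w w')) gs ≡ (w ∧ w'))
agreement-not-∧ v gs P N j P-const N-const w₁ w₁' w₁∧w₁' P₁ w₂ w₂' w₂∧w₂' N₂ realizes =
  refute (lookup gs j) refl
  where
  v∧all = ∧-true (realizes true true)
  impossible : ∀ w w' → w ∧ w' ≡ false → agree (P w w' j) (N w w' j) (lookup gs j) ≡ true → ⊥
  impossible w w' w∧w' agree-j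
    with trans (sym (cong₂ _∧_ (proj₁ v∧all)
                               (allAgree-update _ _ _ _ gs j (P-const w w') (N-const w w') agree-j (proj₂ v∧all))))
               (trans (realizes w w') w∧w')
  ... | ()
  refute : ∀ g → lookup gs j ≡ g → ⊥
  refute true  g-j = impossible w₁ w₁' w₁∧w₁'
    (subst (λ g → agree (P w₁ w₁' j) (N w₁ w₁' j) g ≡ true) (sym g-j) (cong (λ p → agree p (N w₁ w₁' j) true) P₁))
  refute false g-j = impossible w₂ w₂' w₂∧w₂'
    (subst (λ g → agree (P w₂ w₂' j) (N w₂ w₂' j) g ≡ true) (sym g-j)
           (trans (cong (λ q → agree (P w₂ w₂' j) q false) N₂) (∨-zeroʳ _)))

quotient : {m : ℕ} (il y : Vec Bool (suc m)) → Vec Bool (suc m)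
quotient il y = proj₁ (divide il (replicate _ false) y)

productHigh : {m : ℕ} (il y : Vec Bool (suc m)) → Vec Bool (suc m)
productHigh il y = proj₂ (divide il (replicate _ false) y)

module _ {m : ℕ} (y il ih : Vec Bool (suc m)) (y-odd : head y ≡ true) where

  private
    n = suc m
    I = value il + 2 ^ n * value ih
    q = quotient il y
    r = productHigh il y

    divide-from-zero : value y * value q ≡ 2 ^ n * value r + value il
    divide-from-zero = trans (cong (_+ value y * value q) (sym (value-replicate-false n)))
                             (divide-correct il (replicate n false) y y-odd)

  division-sound : (x : Vec Bool n) → equal r ih ≡ true → equal x q ≡ true → value x * value y ≡ I
  division-sound x r≡ih x≡q = begin
    value x * value y             ≡⟨ cong (λ v → value v * value y) (equal-sound x q x≡q) ⟩
    value q * value y             ≡⟨ *-comm (value q) (value y) ⟩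
    value y * value q             ≡⟨ divide-from-zero ⟩
    2 ^ n * value r + value il    ≡⟨ cong (λ v → 2 ^ n * value v + value il) (equal-sound r ih r≡ih) ⟩
    2 ^ n * value ih + value il   ≡⟨ +-comm (2 ^ n * value ih) (value il) ⟩
    I                             ∎
    where open ≡-Reasoning

  division-complete : (x : Vec Bool n) → value x * value y ≡ I → equal r ih ≡ true × equal x q ≡ true
  division-complete x xy≡I =
    let x≡q , r≡ih = odd-*-cancel (value (tail y)) x q (value r) (value ih)
                        (subst (λ Y → Y * value x + 2 ^ n * value r ≡ Y * value q + 2 ^ n * value ih) y-value (begin
          Y * value x + 2 ^ n * value r   ≡⟨ cong (_+ 2 ^ n * value r) (*-comm Y (value x)) ⟩
          value x * Y + 2 ^ n * value r   ≡⟨ cong (_+ 2 ^ n * value r) xy≡I ⟩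
          I + 2 ^ n * value r             ≡⟨ swap (value il) (2 ^ n) (value ih) (value r) ⟩
          (2 ^ n * value r + value il) + 2 ^ n * value ih ≡⟨ cong (_+ 2 ^ n * value ih) (sym divide-from-zero) ⟩
          Y * value q + 2 ^ n * value ih  ∎))
    in subst (λ v → equal v ih ≡ true) (sym (value-injective r ih r≡ih)) (equal-refl ih) ,
       subst (λ v → equal x v ≡ true) x≡q (equal-refl x)
    where
    open ≡-Reasoning
    Y = value y
    y-value : value y ≡ 1 + 2 * value (tail y)
    y-value = cong (λ b → bit b + 2 * value (tail y)) y-odd
    swap : ∀ l p h r → (l + p * h) + p * r ≡ (p * r + l) + p * h
    swap = solve-∀

  quotient-check : (x : Vec Bool n) → (equal r ih ∧ equal x q) ≡ (value x * value y ≡ᵇ I)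
  quotient-check x = ⇔→≡ (mk⇔ sound complete)
    where
    sound : (equal r ih ∧ equal x q) ≡ true → (value x * value y ≡ᵇ I) ≡ true
    sound e = let r≡ih , x≡q = ∧-true e in ≡⇒≡ᵇ-true (division-sound x r≡ih x≡q)
    complete : (value x * value y ≡ᵇ I) ≡ true → (equal r ih ∧ equal x q) ≡ true
    complete e = let r≡ih , x≡q = division-complete x (≡ᵇ-true⇒≡ e) in cong₂ _∧_ r≡ih x≡q

validDivision : {m : ℕ} (y il ih : Vec Bool (suc m)) → Bool
validDivision y il ih = head il ∧ (head y ∧ equal (productHigh il y) ih)

divisionCheck : {m : ℕ} (y il ih xp xn : Vec Bool (suc m)) → Bool
divisionCheck y il ih xp xn = validDivision y il ih ∧ allAgree xp xn (quotient il y)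

divisionCheck-correct : {m : ℕ} (y il ih : Vec Bool (suc m)) (f : Fin (suc m) → Bool) →
  divisionCheck y il ih (tabulate f) (tabulate (not ∘ f))
  ≡ (((value il + 2 ^ suc m * value ih) % 2 ≡ᵇ 1) ∧ ((value y % 2 ≡ᵇ 1)
     ∧ (value (tabulate f) * value y ≡ᵇ value il + 2 ^ suc m * value ih)))
divisionCheck-correct {m} y il ih f = begin
  (head il ∧ (head y ∧ equal r ih)) ∧ allAgree x (tabulate (not ∘ f)) q
    ≡⟨ cong ((head il ∧ (head y ∧ equal r ih)) ∧_) (allAgree-complement f q) ⟩
  (head il ∧ (head y ∧ equal r ih)) ∧ equal x q
    ≡⟨ trans (∧-assoc (head il) _ _) (cong (head il ∧_) (∧-assoc (head y) _ _)) ⟩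
  head il ∧ (head y ∧ (equal r ih ∧ equal x q))
    ≡⟨ cong (head il ∧_) (∧-cong-true (λ y-odd → quotient-check y il ih y-odd x)) ⟩
  head il ∧ (head y ∧ (value x * value y ≡ᵇ I))
    ≡⟨ cong₂ (λ a b → a ∧ (b ∧ (value x * value y ≡ᵇ I))) (sym I-odd) (sym (isOdd-bit (head y) (value (tail y)))) ⟩
  (I % 2 ≡ᵇ 1) ∧ ((value y % 2 ≡ᵇ 1) ∧ (value x * value y ≡ᵇ I)) ∎
  where
  open ≡-Reasoning
  x = tabulate f
  q = quotient il y
  r = productHigh il y
  I = value il + 2 ^ suc m * value ih
  ∧-cong-true : ∀ {b c d} → (b ≡ true → c ≡ d) → b ∧ c ≡ b ∧ d
  ∧-cong-true {true}  c≡d = c≡d refl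
  ∧-cong-true {false} c≡d = refl
  regroup : ∀ b l p h → b + 2 * l + 2 * p * h ≡ b + 2 * (l + p * h)
  regroup = solve-∀
  I-odd : (I % 2 ≡ᵇ 1) ≡ head il
  I-odd = trans (cong (λ z → z % 2 ≡ᵇ 1) (regroup (bit (head il)) (value (tail il)) (2 ^ m) (value ih)))
                (isOdd-bit (head il) (value (tail il) + 2 ^ m * value ih))

module LeafSets {V : Set} (_≟_ : DecidableEquality V) where

  open LitNotions _≟_

  ⌊≟⌋-refl : (v : V) → ⌊ v ≟ v ⌋ ≡ true
  ⌊≟⌋-refl v with v ≟ v
  ... | yes _  = refl
  ... | no v≢v = ⊥-elim (v≢v refl)

  litEq-refl : (ℓ : Lit V) → litEq ℓ ℓ ≡ true
  litEq-refl (pos v) = ⌊≟⌋-refl v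
  litEq-refl (neg v) = ⌊≟⌋-refl v

  litEq-sound : (ℓ ℓ' : Lit V) → litEq ℓ ℓ' ≡ true → ℓ ≡ ℓ'
  litEq-sound (pos u) (pos v) e with u ≟ v
  ... | yes refl = refl
  litEq-sound (neg u) (neg v) e with u ≟ v
  ... | yes refl = refl

  litEq-distinct : (ℓ ℓ' : Lit V) → litVar ℓ ≢ litVar ℓ' → litEq ℓ ℓ' ≡ false
  litEq-distinct ℓ ℓ' vars-differ with litEq ℓ ℓ' in e
  ... | false = refl
  ... | true  = ⊥-elim (vars-differ (cong litVar (litEq-sound ℓ ℓ' e)))

  litEq-negLit : (ℓ : Lit V) → litEq ℓ (negLit ℓ) ≡ false
  litEq-negLit (pos v) = refl
  litEq-negLit (neg v) = refl

  isLitLabelAt : Lit V → Maybe (Label V) → Bool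
  isLitLabelAt ℓ (just l) = isLitLabel ℓ l
  isLitLabelAt ℓ nothing  = false

  leavesOf : {k : ℕ} → Circ V k → Lit V → Subset k
  leavesOf G ℓ = tabulate (λ i → isLitLabelAt ℓ (labelAt G i))

  lookup-leavesOf : {k : ℕ} (G : Circ V k) (ℓ : Lit V) (i : Fin k) {l : Label V} → labelAt G i ≡ just l →
                    lookup (leavesOf G ℓ) i ≡ isLitLabel ℓ l
  lookup-leavesOf G ℓ i e = trans (lookup∘tabulate _ i) (cong (isLitLabelAt ℓ) e)

  leavesOf-leaves : {k : ℕ} (G : Circ V k) (ℓ : Lit V) → LeavesOf G ℓ (leavesOf G ℓ)
  leavesOf-leaves G ℓ i e with labelAt G i | trans (sym (lookup∘tabulate (λ i → isLitLabelAt ℓ (labelAt G i)) i)) e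
  ... | just (lit ℓ') | ℓ≡ℓ' = cong (just ∘ lit) (sym (litEq-sound ℓ ℓ' ℓ≡ℓ'))

  leavesOf-disjoint : {k : ℕ} (G : Circ V k) {ℓ ℓ' : Lit V} → ℓ ≢ ℓ' → Disjoint (leavesOf G ℓ) (leavesOf G ℓ')
  leavesOf-disjoint G {ℓ} {ℓ'} ℓ≢ℓ' i (i∈ℓ , i∈ℓ') =
    ℓ≢ℓ' (lit-injective (trans (sym (leavesOf-leaves G ℓ i i∈ℓ)) (leavesOf-leaves G ℓ' i i∈ℓ')))
    where
    lit-injective : {a b : Lit V} → just (lit a) ≡ just (lit b) → a ≡ b
    lit-injective refl = refl

  module _ {k : ℕ} (G : Circ V k) (ℓ : Lit V) (r : Label V → Label V) where

    relabelSet-leavesOf : (b : Bool) → relabelSet (leavesOf G ℓ) b (relabel (λ _ → r) G)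
                          ≡ relabel (λ _ l → if isLitLabel ℓ l then const b else r l) G
    relabelSet-leavesOf b =
      trans (relabel-∘ _ _ G)
            (relabel-cong _ _ G λ i l e → cong (λ t → if t then const b else r l) (lookup-leavesOf G ℓ i e))

    -- Leaves that r relabels to ℓ were ℓ-leaves of G already, so no ℓ-leaf lies outside the set.
    killOthers-leavesOf : (∀ l → isLitLabel ℓ (r l) ≡ true → r l ≡ l) →
                          killOthers ℓ (leavesOf G ℓ) (relabel (λ _ → r) G) ≡ relabel (λ _ → r) G
    killOthers-leavesOf creates-no-ℓ = trans (relabel-∘ _ _ G) (relabel-cong _ _ G keep)
      where
      keep : ∀ i l → labelAt G i ≡ just l →
             (if isLitLabel ℓ (r l) ∧ not (lookup (leavesOf G ℓ) i) then const false else r l) ≡ r l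
      keep i l e rewrite lookup-leavesOf G ℓ i e with isLitLabel ℓ (r l) in rl-is-ℓ
      ... | false = refl
      ... | true rewrite trans (cong (isLitLabel ℓ) (sym (creates-no-ℓ l rl-is-ℓ))) rl-is-ℓ = refl

∈-ʳ++⁺ : {A : Set} {x : A} (xs ys : List A) → x ∈ xs ⊎ x ∈ ys → x ∈ xs ʳ++ ys
∈-ʳ++⁺ []       ys (inj₂ x∈ys)        = x∈ys
∈-ʳ++⁺ (y ∷ xs) ys (inj₁ (here refl))  = ∈-ʳ++⁺ xs (y ∷ ys) (inj₂ (here refl))
∈-ʳ++⁺ (y ∷ xs) ys (inj₁ (there x∈xs)) = ∈-ʳ++⁺ xs (y ∷ ys) (inj₁ x∈xs)
∈-ʳ++⁺ (y ∷ xs) ys (inj₂ x∈ys)        = ∈-ʳ++⁺ xs (y ∷ ys) (inj₂ (there x∈ys))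

module DivisionCircuit (m : ℕ) where

  n : ℕ
  n = suc m

  -- Circuits are evaluated on valuations of leaf labels rather than of variables, because the
  -- SAUNF conditions substitute the two polarities of an X-variable independently; only the
  -- leaves over Y and I are required to carry complementary values.
  Consistent : LabelValuation (Var n) → Set
  Consistent ρ = (∀ b → ρ (const b) ≡ b) × (∀ v → ¬ IsX v → ρ (lit (neg v)) ≡ not (ρ (lit (pos v))))

  open Builder Consistent proj₁ public

  yBits iLowBits iHighBits xPosBits xNegBits : LabelValuation (Var n) → Vec Bool n
  yBits  ρ = tabulate (λ a → ρ (lit (pos (yv a))))
  iLowBits ρ = tabulate (λ a → ρ (lit (pos (iv (a ↑ˡ n)))))
  iHighBits ρ = tabulate (λ a → ρ (lit (pos (iv (n ↑ʳ a)))))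
  xPosBits ρ = tabulate (λ a → ρ (lit (pos (xv a))))
  xNegBits ρ = tabulate (λ a → ρ (lit (neg (xv a))))

  divisionSem : LabelValuation (Var n) → Bool
  divisionSem ρ = divisionCheck (yBits ρ) (iLowBits ρ) (iHighBits ρ) (xPosBits ρ) (xNegBits ρ)

  coreCost : ℕ
  coreCost = 1 + allAgreeCost n + 2 + 2 + equalCost n + divideCost n m + 2
             + literalsCost n + literalsCost n + literalsCost n

  -- Kept abstract: the rest of the development only needs its interface, and unfolding the
  -- circuit it builds makes type checking prohibitively slow.
  abstract
    core : Build [] coreCost (λ c → Node c divisionSem)
    core =
      literalsᴰ yv (λ a ρ γ → proj₂ γ (yv a) λ ()) >>= λ e₁ Y →
      literalsᴰ (iv ∘ (_↑ˡ n)) (λ a ρ γ → proj₂ γ (iv (a ↑ˡ n)) λ ()) >>= λ e₂ IL →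
      literalsᴰ (iv ∘ (n ↑ʳ_)) (λ a ρ γ → proj₂ γ (iv (n ↑ʳ a)) λ ()) >>= λ e₃ IH →
      constᴰ false >>= λ e₄ off →
      divideᴰ (weakenⱽ e₄ (weakenⱽ e₃ IL)) (replicateᴰ off) (weakenⱽ e₄ (weakenⱽ e₃ (weakenⱽ e₂ Y))) off >>= λ e₅ (q , r) →
      equalᴰ r (weakenⱽ e₅ (weakenⱽ e₄ IH)) >>= λ e₆ r≡ih →
      andᴰ (weakenᴰ e₆ (weakenᴰ e₅ (weakenᴰ e₄ (weakenᴰ e₃ (weakenᴰ e₂ (headⱽ Y)))))) r≡ih >>= λ e₇ y-odd →
      andᴰ (weakenᴰ e₇ (weakenᴰ e₆ (weakenᴰ e₅ (weakenᴰ e₄ (weakenᴰ e₃ (headⱽ IL)))))) y-odd >>= λ e₈ valid →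
      allAgreeᴺ xv (weakenⱽ e₈ (weakenⱽ e₇ (weakenⱽ e₆ q))) >>= λ e₉ agreement →
      andGate (weaken e₉ (proj₁ valid)) agreement

  size : ℕ
  size = Build.size core

  divisionCircuit : Circ (Var n) (suc (suc (double size)))
  divisionCircuit = rootAt (Build.circuit core) (index (Build.result core))

  divisionCircuit-allDescendants : AllDescendants divisionCircuit
  divisionCircuit-allDescendants = rootAt-allDescendants (Build.circuit core) (index (Build.result core))

  coreCost≡ : coreCost ≡ 20 * n * n + 26 * n + 10
  coreCost≡ =
    trans (cong₂ (λ (a , e) (d , l) → 1 + a + 2 + 2 + e + d + 2 + l + l + l)
                 (cong₂ _,_ (allAgreeCost≡ n) (equalCost≡ n)) (cong₂ _,_ (divideCost≡ n m) (literalsCost≡ n)))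
          (collect m)
    where
    collect : ∀ m → 1 + (6 * suc m + 1) + 2 + 2 + (8 * suc m + 2) + suc m * (20 * suc m + 6) + 2
                    + 2 * suc m + 2 * suc m + 2 * suc m ≡ 20 * suc m * suc m + 26 * suc m + 10
    collect = solve-∀

  divisionCircuit-size : suc (suc (double size)) ≤ 114 * n ^ 2
  divisionCircuit-size = ≤-trans (m≤m+n _ (74 * m * m + 96 * m)) (≤-reflexive (begin
    suc (suc (double size)) + (74 * m * m + 96 * m)
      ≡⟨ cong (λ k → suc (suc k) + (74 * m * m + 96 * m)) (double≡ size) ⟩
    suc (suc (2 * size)) + (74 * m * m + 96 * m)
      ≡⟨ cong (λ k → suc (suc (2 * k)) + (74 * m * m + 96 * m))
              (trans (⊑-size (Build.extends core)) (trans (+-identityʳ coreCost) coreCost≡)) ⟩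
    suc (suc (2 * (20 * n * n + 26 * n + 10))) + (74 * m * m + 96 * m)
      ≡⟨ collect m ⟩
    114 * n ^ 2 ∎))
    where
    open ≡-Reasoning
    collect : ∀ m → suc (suc (2 * (20 * suc m * suc m + 26 * suc m + 10))) + (74 * m * m + 96 * m)
                    ≡ 114 * (suc m * (suc m * 1))
    collect = solve-∀

  XLabel : Label (Var n) → Set
  XLabel (lit ℓ)   = IsX (litVar ℓ)
  XLabel (const _) = ⊥

  OnlyOnX : (Label (Var n) → Label (Var n)) → Set
  OnlyOnX r = ∀ l → ¬ XLabel l → r l ≡ l

  consistent-onlyOnX : (σ : Var n → Bool) {r : Label (Var n) → Label (Var n)} → OnlyOnX r → Consistent (labelVal σ ∘ r)
  consistent-onlyOnX σ {r} fix =
    (λ b → cong (labelVal σ) (fix (const b) λ ())) ,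
    (λ v v∉X → trans (cong (labelVal σ) (fix (lit (neg v)) v∉X))
                     (cong (not ∘ labelVal σ) (sym (fix (lit (pos v)) v∉X))))

  eval-relabel : (σ : Var n → Bool) {r : Label (Var n) → Label (Var n)} → OnlyOnX r →
                 eval σ (relabel (λ _ → r) divisionCircuit)
                 ≡ divisionCheck (yBits (labelVal σ)) (iLowBits (labelVal σ)) (iHighBits (labelVal σ))
                                 (xPosBits (labelVal σ ∘ r)) (xNegBits (labelVal σ ∘ r))
  eval-relabel σ {r} fix = begin
    eval σ (relabel (λ _ → r) divisionCircuit)
      ≡⟨ cong head (trans (vals≡nodeValues σ (relabel (λ _ → r) divisionCircuit))
                          (nodeValues-relabel (labelVal σ) r divisionCircuit)) ⟩
    lookup (nodeValues ρ divisionCircuit) zero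
      ≡⟨ rootAt-value (Build.circuit core) (index (Build.result core)) ρ (proj₁ (consistent-onlyOnX σ fix) true) ⟩
    lookup (nodeValues ρ (Build.circuit core)) (index (Build.result core))
      ≡⟨ computes (Build.result core) ρ (consistent-onlyOnX σ fix) ⟩
    divisionSem ρ
      ≡⟨ cong₂ (λ y (il , ih) → divisionCheck y il ih (xPosBits ρ) (xNegBits ρ))
               (tabulate-cong (λ a → unchanged (pos (yv a)) λ ()))
               (cong₂ _,_ (tabulate-cong (λ a → unchanged (pos (iv (a ↑ˡ n))) λ ()))
                          (tabulate-cong (λ a → unchanged (pos (iv (n ↑ʳ a))) λ ()))) ⟩
    divisionCheck (yBits (labelVal σ)) (iLowBits (labelVal σ)) (iHighBits (labelVal σ)) (xPosBits ρ) (xNegBits ρ) ∎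
    where
    open ≡-Reasoning
    ρ = labelVal σ ∘ r
    unchanged : (ℓ : Lit (Var n)) → ¬ IsX (litVar ℓ) → ρ (lit ℓ) ≡ labelVal σ (lit ℓ)
    unchanged ℓ ℓ∉X = cong (labelVal σ) (fix (lit ℓ) ℓ∉X)

  divisionCircuit-represents : Represents divisionCircuit divSpec
  divisionCircuit-represents σ = begin
    eval σ divisionCircuit                          ≡⟨ cong (eval σ) (sym (relabel-id divisionCircuit)) ⟩
    eval σ (relabel (λ _ l → l) divisionCircuit)    ≡⟨ eval-relabel σ (λ _ _ → refl) ⟩
    divisionCheck Y IL IH (tabulate x) (tabulate (not ∘ x)) ≡⟨ divisionCheck-correct Y IL IH x ⟩
    spec (value IL + 2 ^ n * value IH) (value (tabulate x) , value Y)
      ≡⟨ cong₂ spec I-value (cong₂ _,_ (sym (bitsVal≡value x)) (sym (bitsVal≡value (σ ∘ yv)))) ⟩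
    divSpec σ                                       ∎
    where
    open ≡-Reasoning
    spec : ℕ → ℕ × ℕ → Bool
    spec I (X , Y) = (I % 2 ≡ᵇ 1) ∧ ((Y % 2 ≡ᵇ 1) ∧ (X * Y ≡ᵇ I))
    x = σ ∘ xv
    Y = yBits (labelVal σ)
    IL = iLowBits (labelVal σ)
    IH = iHighBits (labelVal σ)
    I-value : value IL + 2 ^ n * value IH ≡ valI σ
    I-value = sym (trans (bitsVal-++ n n (σ ∘ iv))
                         (cong₂ (λ l h → l + 2 ^ n * h) (bitsVal≡value (λ a → σ (iv (a ↑ˡ n))))
                                                        (bitsVal≡value (λ a → σ (iv (n ↑ʳ a))))))

module DivisionSAUNF (m : ℕ) where

  open DivisionCircuit m
  open LitNotions (_≟Var_ {n})
  open LeafSets (_≟Var_ {n})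

  G : Circ (Var n) (suc (suc (double size)))
  G = divisionCircuit

  xLit : Lit (Fin n) → Lit (Var n)
  xLit (pos a) = pos (xv a)
  xLit (neg a) = neg (xv a)

  xv-injective : {a b : Fin n} → xv a ≡ xv b → a ≡ b
  xv-injective refl = refl

  xLit-injective : {x y : Lit (Fin n)} → xLit x ≡ xLit y → x ≡ y
  xLit-injective {pos a} {pos .a} refl = refl
  xLit-injective {neg a} {neg .a} refl = refl

  isLitLabel-xLit : (x : Lit (Fin n)) (l : Label (Var n)) → ¬ XLabel l → isLitLabel (xLit x) l ≡ false
  isLitLabel-xLit x       (const b)           l∉X = refl
  isLitLabel-xLit (pos a) (lit (pos (xv b))) l∉X = ⊥-elim (l∉X tt)
  isLitLabel-xLit (pos a) (lit (pos (yv b))) l∉X = refl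
  isLitLabel-xLit (pos a) (lit (pos (iv b))) l∉X = refl
  isLitLabel-xLit (pos a) (lit (neg v))      l∉X = refl
  isLitLabel-xLit (neg a) (lit (neg (xv b))) l∉X = ⊥-elim (l∉X tt)
  isLitLabel-xLit (neg a) (lit (neg (yv b))) l∉X = refl
  isLitLabel-xLit (neg a) (lit (neg (iv b))) l∉X = refl
  isLitLabel-xLit (neg a) (lit (pos v))      l∉X = refl

  markTrue : List (Lit (Fin n)) → Label (Var n) → Label (Var n)
  markTrue []      l = l
  markTrue (x ∷ D) l = if isLitLabel (xLit x) l then const true else markTrue D l

  markTrue-cases : (D : List (Lit (Fin n))) (l : Label (Var n)) → markTrue D l ≡ l ⊎ markTrue D l ≡ const true
  markTrue-cases []      l = inj₁ refl
  markTrue-cases (x ∷ D) l with isLitLabel (xLit x) l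
  ... | true  = inj₂ refl
  ... | false = markTrue-cases D l

  markTrue-onlyOnX : (D : List (Lit (Fin n))) → OnlyOnX (markTrue D)
  markTrue-onlyOnX []      l l∉X = refl
  markTrue-onlyOnX (x ∷ D) l l∉X rewrite isLitLabel-xLit x l l∉X = markTrue-onlyOnX D l l∉X

  markTrue-∈ : {x : Lit (Fin n)} (D : List (Lit (Fin n))) → x ∈ D → markTrue D (lit (xLit x)) ≡ const true
  markTrue-∈ {x} (y ∷ D) (here refl) rewrite litEq-refl (xLit x) = refl
  markTrue-∈ {x} (y ∷ D) (there x∈D) with isLitLabel (xLit y) (lit (xLit x))
  ... | true  = refl
  ... | false = markTrue-∈ D x∈D

  substLabel : Lit (Var n) → Bool → Bool → Label (Var n) → Label (Var n)
  substLabel ℓ a b l = if isLitLabel ℓ l then const a else if isLitLabel (negLit ℓ) l then const b else l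

  negate : Lit (Fin n) → Lit (Fin n)
  negate (pos a) = neg a
  negate (neg a) = pos a

  negLit-xLit : (x : Lit (Fin n)) → negLit (xLit x) ≡ xLit (negate x)
  negLit-xLit (pos a) = refl
  negLit-xLit (neg a) = refl

  substLabel-onlyOnX : (x : Lit (Fin n)) (a b : Bool) → OnlyOnX (substLabel (xLit x) a b)
  substLabel-onlyOnX x a b l l∉X
    rewrite isLitLabel-xLit x l l∉X | negLit-xLit x | isLitLabel-xLit (negate x) l l∉X = refl

  markedCircuit : List (Lit (Fin n)) → Circ (Var n) (suc (suc (double size)))
  markedCircuit D = relabel (λ _ → markTrue D) G

  leaves : Lit (Fin n) → Subset (suc (suc (double size)))
  leaves x = leavesOf G (xLit x)

  relabelSet-marked : (D : List (Lit (Fin n))) (x : Lit (Fin n)) →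
                      relabelSet (leaves x) true (markedCircuit D) ≡ markedCircuit (x ∷ D)
  relabelSet-marked D x = relabelSet-leavesOf G (xLit x) (markTrue D) true

  killOthers-marked : (D : List (Lit (Fin n))) (x : Lit (Fin n)) →
                      killOthers (xLit x) (leaves x) (markedCircuit D) ≡ markedCircuit D
  killOthers-marked D x = killOthers-leavesOf G (xLit x) (markTrue D) creates-no-x
    where
    creates-no-x : ∀ l → isLitLabel (xLit x) (markTrue D l) ≡ true → markTrue D l ≡ l
    creates-no-x l e with markTrue-cases D l
    ... | inj₁ unchanged = unchanged
    ... | inj₂ marked rewrite marked with () ← e

  var-xLit : (x : Lit (Fin n)) → xv (litVar x) ≡ litVar (xLit x)
  var-xLit (pos a) = refl
  var-xLit (neg a) = refl

  var-negLit-xLit : (x : Lit (Fin n)) → xv (litVar x) ≡ litVar (negLit (xLit x))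
  var-negLit-xLit (pos a) = refl
  var-negLit-xLit (neg a) = refl

  onlyOnX-∘ : {r s : Label (Var n) → Label (Var n)} → OnlyOnX r → OnlyOnX s → OnlyOnX (s ∘ r)
  onlyOnX-∘ {r} {s} r-fix s-fix l l∉X = trans (cong s (r-fix l l∉X)) (s-fix l l∉X)

  module Substituted (D : List (Lit (Fin n))) (x : Lit (Fin n)) (σ : Var n → Bool) where

    ρ : Bool → Bool → LabelValuation (Var n)
    ρ w w' = labelVal σ ∘ substLabel (xLit x) w w' ∘ markTrue D

    valid : Bool
    valid = validDivision (yBits (labelVal σ)) (iLowBits (labelVal σ)) (iHighBits (labelVal σ))

    q : Vec Bool n
    q = quotient (iLowBits (labelVal σ)) (yBits (labelVal σ))

    P N : Bool → Bool → Fin n → Bool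
    P w w' a = ρ w w' (lit (pos (xv a)))
    N w w' a = ρ w w' (lit (neg (xv a)))

    eval-substituted : (w w' : Bool) →
      eval σ (substLit (xLit x) w w' (killOthers (xLit x) (leaves x) (markedCircuit D)))
      ≡ divisionCheck (yBits (labelVal σ)) (iLowBits (labelVal σ)) (iHighBits (labelVal σ))
                      (tabulate (P w w')) (tabulate (N w w'))
    eval-substituted w w' =
      trans (cong (eval σ ∘ substLit (xLit x) w w') (killOthers-marked D x))
            (trans (cong (eval σ) (relabel-∘ (λ _ → substLabel (xLit x) w w') (λ _ → markTrue D) G))
                   (eval-relabel σ (onlyOnX-∘ (markTrue-onlyOnX D) (substLabel-onlyOnX x w w'))))

    untouched : (w w' : Bool) (ℓ : Lit (Var n)) → litVar ℓ ≢ xv (litVar x) → ρ w w' (lit ℓ) ≡ ρ true true (lit ℓ)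
    untouched w w' ℓ ℓ≁x with markTrue-cases D (lit ℓ)
    ... | inj₂ marked rewrite marked = refl
    ... | inj₁ unmarked rewrite unmarked | litEq-distinct (xLit x) ℓ (ℓ≁x ∘ sym ∘ trans (var-xLit x))
                                         | litEq-distinct (negLit (xLit x)) ℓ (ℓ≁x ∘ sym ∘ trans (var-negLit-xLit x)) = refl

    hit : (b : Bool) → ρ true b (lit (xLit x)) ≡ true
    hit b with markTrue-cases D (lit (xLit x))
    ... | inj₁ unmarked rewrite unmarked | litEq-refl (xLit x) = refl
    ... | inj₂ marked   rewrite marked = refl

    refute : (w₁ w₁' : Bool) → w₁ ∧ w₁' ≡ false → P w₁ w₁' (litVar x) ≡ true →
             (w₂ w₂' : Bool) → w₂ ∧ w₂' ≡ false → N w₂ w₂' (litVar x) ≡ true →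
             ¬ (∀ w w' → eval σ (substLit (xLit x) w w' (killOthers (xLit x) (leaves x) (markedCircuit D))) ≡ (w ∧ w'))
    refute w₁ w₁' w₁∧w₁' P₁ w₂ w₂' w₂∧w₂' N₂ realizes =
      agreement-not-∧ valid q P N (litVar x)
        (λ w w' a a≢x → untouched w w' (pos (xv a)) (a≢x ∘ xv-injective))
        (λ w w' a a≢x → untouched w w' (neg (xv a)) (a≢x ∘ xv-injective))
        w₁ w₁' w₁∧w₁' P₁ w₂ w₂' w₂∧w₂' N₂
        (λ w w' → trans (sym (eval-substituted w w')) (realizes w w'))

    hit-negate : (a : Bool) → ρ a true (lit (xLit (negate x))) ≡ true
    hit-negate a with markTrue-cases D (lit (xLit (negate x)))
    ... | inj₂ marked   rewrite marked = refl
    ... | inj₁ unmarked rewrite unmarked | sym (negLit-xLit x) | litEq-negLit (xLit x) | litEq-refl (negLit (xLit x)) = refl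

  marked-unrealizable : (D : List (Lit (Fin n))) (x : Lit (Fin n)) → SetAndUnrealizable (markedCircuit D) (xLit x) (leaves x)
  marked-unrealizable D (pos j) (σ , realizes) =
    refute true false refl (hit false) false true refl (hit-negate false) realizes
    where open Substituted D (pos j) σ
  marked-unrealizable D (neg j) (σ , realizes) =
    refute false true refl (hit-negate false) true false refl (hit false) realizes
    where open Substituted D (neg j) σ

  sets : Lit (Fin n) → Lit (Var n) × Subset (suc (suc (double size)))
  sets x = xLit x , leaves x

  unrealChain-marked : (D xs : List (Lit (Fin n))) → UnrealChain (markedCircuit D) (map sets xs)
  unrealChain-marked D []       = tt
  unrealChain-marked D (x ∷ xs) =
    marked-unrealizable D x ,
    subst (λ c → UnrealChain c (map sets xs)) (sym (relabelSet-marked D x)) (unrealChain-marked (x ∷ D) xs)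

  setAllTrue-marked : (D xs : List (Lit (Fin n))) → setAllTrue (map sets xs) (markedCircuit D) ≡ markedCircuit (xs ʳ++ D)
  setAllTrue-marked D []       = refl
  setAllTrue-marked D (x ∷ xs) rewrite relabelSet-marked D x = setAllTrue-marked (x ∷ D) xs

  xLiterals : List (Lit (Fin n))
  xLiterals = map pos (allFin n) ++ map neg (allFin n)

  ∈-xLiterals : (x : Lit (Fin n)) → x ∈ xLiterals
  ∈-xLiterals (pos a) = ∈-++⁺ˡ (∈-map⁺ pos (∈-allFin a))
  ∈-xLiterals (neg a) = ∈-++⁺ʳ (map pos (allFin n)) (∈-map⁺ neg (∈-allFin a))

  xLiterals-unique : Unique xLiterals
  xLiterals-unique =
    Unique.++⁺ (Unique.map⁺ pos-injective (Unique.allFin⁺ n)) (Unique.map⁺ neg-injective (Unique.allFin⁺ n)) pos≢neg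
    where
    pos-injective : {a b : Fin n} → pos a ≡ pos b → a ≡ b
    pos-injective refl = refl
    neg-injective : {a b : Fin n} → neg a ≡ neg b → a ≡ b
    neg-injective refl = refl
    pos≢neg : {x : Lit (Fin n)} → ¬ (x ∈ map pos (allFin n) × x ∈ map neg (allFin n))
    pos≢neg (p , q) with ∈-map⁻ pos p | ∈-map⁻ neg q
    ... | _ , _ , refl | _ , _ , ()

  saunfSets : List (Lit (Var n) × Subset (suc (suc (double size))))
  saunfSets = map sets xLiterals

  eval-allMarked : (σ : Var n → Bool) → eval σ (setAllTrue saunfSets G)
                   ≡ divisionCheck (yBits (labelVal σ)) (iLowBits (labelVal σ)) (iHighBits (labelVal σ))
                                   (tabulate (λ _ → true)) (tabulate (λ _ → true))
  eval-allMarked σ = begin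
    eval σ (setAllTrue saunfSets G)            ≡⟨ cong (eval σ ∘ setAllTrue saunfSets) (sym (relabel-id G)) ⟩
    eval σ (setAllTrue saunfSets (markedCircuit []))  ≡⟨ cong (eval σ) (setAllTrue-marked [] xLiterals) ⟩
    eval σ (markedCircuit allMarked)                  ≡⟨ eval-relabel σ (markTrue-onlyOnX allMarked) ⟩
    divisionCheck Y IL IH (xPosBits (labelVal σ ∘ markTrue allMarked)) (xNegBits (labelVal σ ∘ markTrue allMarked))
      ≡⟨ cong₂ (divisionCheck Y IL IH) (tabulate-cong (isMarked ∘ pos)) (tabulate-cong (isMarked ∘ neg)) ⟩
    divisionCheck Y IL IH (tabulate (λ _ → true)) (tabulate (λ _ → true)) ∎
    where
    open ≡-Reasoning
    allMarked = xLiterals ʳ++ []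
    Y = yBits (labelVal σ)
    IL = iLowBits (labelVal σ)
    IH = iHighBits (labelVal σ)
    isMarked : (x : Lit (Fin n)) → labelVal σ (markTrue allMarked (lit (xLit x))) ≡ true
    isMarked x = cong (labelVal σ) (markTrue-∈ allMarked (∈-ʳ++⁺ xLiterals [] (inj₁ (∈-xLiterals x))))

  allMarked-independent : IndependentOf IsX (λ σ → eval σ (setAllTrue saunfSets G))
  allMarked-independent σ σ' agree-off-X =
    trans (eval-allMarked σ)
          (trans (cong₂ (λ y (il , ih) → divisionCheck y il ih all-true all-true)
                        (tabulate-cong (λ a → agree-off-X (yv a) λ ()))
                        (cong₂ _,_ (tabulate-cong (λ a → agree-off-X (iv (a ↑ˡ n)) λ ()))
                                   (tabulate-cong (λ a → agree-off-X (iv (n ↑ʳ a)) λ ()))))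
                 (sym (eval-allMarked σ')))
    where
    all-true = tabulate (λ _ → true)

  divisionCircuit-saunf : SAUNF IsX G saunfSets
  divisionCircuit-saunf =
    (λ ()) ,
    AllPairs.map⁺ (AllPairs.map (leavesOf-disjoint G ∘ (_∘ xLit-injective)) xLiterals-unique) ,
    All.map⁺ (All.tabulate (λ {x} _ → xIsX x , leavesOf-leaves G (xLit x))) ,
    subst (λ c → UnrealChain c saunfSets) (relabel-id G) (unrealChain-marked [] xLiterals) ,
    allMarked-independent
    where
    xIsX : (x : Lit (Fin n)) → IsX (litVar (xLit x))
    xIsX (pos a) = tt
    xIsX (neg a) = tt

theorem7 : ∃[ c ] ∃[ d ] ((n : ℕ) → 1 ≤ n →
             ∃[ k ] Σ (Circ (Var n) (suc k)) λ G →
               AllDescendants G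
               × suc k ≤ c * n ^ d
               × Represents G divSpec
               × Σ (List (Lit (Var n) × Subset (suc k))) λ Ss → SAUNFVar IsX G Ss)
theorem7 = 114 , 2 , λ where
  (suc m) (s≤s z≤n) →
    let open DivisionCircuit m
        open DivisionSAUNF m
    in suc (double size) , divisionCircuit , divisionCircuit-allDescendants , divisionCircuit-size ,
       divisionCircuit-represents , saunfSets , divisionCircuit-saunf
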